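{- Let $a,b,c$ be complex numbers, let $$\Omega_n(a,b,c):=\sum_{k=0}^{n-1}q^k\frac{(b/q;q)_k(cq;q)_{2k}}{(aq^3,c/(aq);q)_k(bcq^2;q^3)_k},\qquad \mathcal K_m(a,b,c):=\sum_{k=0}^{m-1}q^k\frac{(1/(aq);q)_{2k}(b/q;q)_k}{(q/c,c/(aq);q)_k(b/a;q^3)_k}.$$ Then for all integers $m,n\ge0$ (whenever no denominator vanishes) $$\Omega_n(a,b,c)-\Omega_n(a/q^{2m},bq^m,c/q^m)\frac{(1/(aq^2);q)_{2m}(b/q;q)_m}{(c/(aq),1/c;q)_m(b/(aq^3);q^3)_m}$$ $$=\frac{(1-aq^2)(1-q/(bc))}{(1-aq^3/b)(1-1/c)}\left\{\mathcal K_m(a,b,c)-\mathcal K_m(aq^n,bq^n,cq^{2n})\frac{(b/q;q)_n(c;q)_{2n}}{(aq^2,c/(aq);q)_n(bc/q;q^3)_n}\right\}.$$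
   Context: $q$ is a complex number with $|q|<1$. For a base $p$ and integer $k\ge0$, $(z;p)_k:=\prod_{j=0}^{k-1}(1-zp^j)$, and $(z_1,\dots,z_m;p)_k:=(z_1;p)_k\cdots(z_m;p)_k$. -}

module Defs where

open import Level using (Level; _⊔_) renaming (suc to lsuc)
open import Data.Nat using (ℕ; zero; suc) renaming (_*_ to _*ℕ_)
open import Relation.Nullary using (¬_)
open import Algebra.Bundles using (CommutativeRing)

-- A field: a commutative ring with 0 ≉ 1 and a total function _⁻¹ that is a
-- two-sided inverse on nonzero elements (value at 0 is irrelevant/junk).
record Field (α β : Level) : Set (lsuc (α ⊔ β)) where
  field
    commutativeRing : CommutativeRing α β
  open CommutativeRing commutativeRing public
  field
    _⁻¹        : Carrier → Carrier
    ⁻¹-inverse : ∀ x → ¬ (x ≈ 0#) → x * (x ⁻¹) ≈ 1#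
    0≉1        : ¬ (0# ≈ 1#)

module FieldOps {α β : Level} (F : Field α β) where
  open Field F

  infixl 6 _−_
  infixl 7 _/_
  infixr 8 _^_

  _−_ : Carrier → Carrier → Carrier
  x − y = x + (- y)

  _/_ : Carrier → Carrier → Carrier
  x / y = x * (y ⁻¹)

  _^_ : Carrier → ℕ → Carrier
  x ^ zero  = 1#
  x ^ suc n = (x ^ n) * x

  NonZero : Carrier → Set β
  NonZero x = ¬ (x ≈ 0#)

  poch : Carrier → Carrier → ℕ → Carrier
  poch z p zero    = 1#
  poch z p (suc k) = poch z p k * (1# − z * p ^ k)

  sumTo : ℕ → (ℕ → Carrier) → Carrier
  sumTo zero    f = 0#
  sumTo (suc n) f = sumTo n f + f n

  ΩDen : Carrier → Carrier → Carrier → Carrier → ℕ → Carrier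
  ΩDen a b c q k =
    poch (a * q ^ 3) q k * poch (c / (a * q)) q k * poch (b * c * q ^ 2) (q ^ 3) k

  ΩNum : Carrier → Carrier → Carrier → Carrier → ℕ → Carrier
  ΩNum a b c q k = poch (b / q) q k * poch (c * q) q (2 *ℕ k)

  Ω : Carrier → Carrier → Carrier → Carrier → ℕ → Carrier
  Ω a b c q n = sumTo n (λ k → q ^ k * ΩNum a b c q k / ΩDen a b c q k)

  KDen : Carrier → Carrier → Carrier → Carrier → ℕ → Carrier
  KDen a b c q k =
    poch (q / c) q k * poch (c / (a * q)) q k * poch (b / a) (q ^ 3) k

  KNum : Carrier → Carrier → Carrier → Carrier → ℕ → Carrier
  KNum a b c q k = poch (1# / (a * q)) q (2 *ℕ k) * poch (b / q) q k

  K : Carrier → Carrier → Carrier → Carrier → ℕ → Carrier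
  K a b c q m = sumTo m (λ k → q ^ k * KNum a b c q k / KDen a b c q k)

{-# OPTIONS --safe #-}
module Submission where

-- Two explicit rational functions f and g of (k, j) form a telescoping pair,
--   f k j − f k (j+1) = g k j − g (k+1) j,
-- which after clearing denominators is a polynomial identity in a, b, c, q, qᵏ and qʲ.
-- Summing it over 0 ≤ k < n, 0 ≤ j < m telescopes in j on the left and in k on the right:
--   Σₖ (f k 0 − f k m) = Σⱼ (g 0 j − g n j).
-- Here f k 0 and f k m are the k-th terms of Ωₙ(a,b,c) and of the shifted Ωₙ times its
-- prefactor, while g 0 j and g n j are the j-th terms of the two 𝒦ₘ sums times the constant
-- in front, so the four boundary sums are the four terms of the identity.

open import Defs
open import Level using (Level)
open import Data.Nat using (ℕ; zero; suc; _<_; _≤_) renaming (_*_ to _*ℕ_)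
import Data.Nat as ℕ
import Data.Nat.Properties as ℕ
import Data.Integer as ℤ
open import Data.Integer using (ℤ)
import Data.Integer.Properties as ℤ
open import Data.Sign as Sign using ()
open import Data.Maybe using (Maybe; just; nothing)
open import Relation.Nullary using (yes; no)
import Relation.Binary.PropositionalEquality as P
open import Algebra.Bundles using (CommutativeRing)
open import Algebra.Solver.Ring.AlmostCommutativeRing
  using (AlmostCommutativeRing; fromCommutativeRing; _-Raw-AlmostCommutative⟶_)

-- The ring solver over an arbitrary commutative ring, with ℤ as coefficient ring so that
-- cancelling terms (x − x = 0) are recognised.
module IntegerCoefficientSolver {c ℓ : Level} (R : CommutativeRing c ℓ) where
  open CommutativeRing R
  open import Algebra.Properties.Semiring.Mult semiring using (_×_; ×1-homo-*; ×-homo-+)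
  open import Algebra.Properties.Ring ring
    using (-‿involutive; -‿distribˡ-*; -‿distribʳ-*; -‿+-comm; -0#≈0#)
  open import Relation.Binary.Reasoning.Setoid setoid

  ⟦_⟧ℤ : ℤ → Carrier
  ⟦ ℤ.+ n ⟧ℤ      = n × 1#
  ⟦ ℤ.-[1+ n ] ⟧ℤ = - (suc n × 1#)

  private
    [1+x]−[1+y]≈x−y : ∀ x y → (1# + x) + - (1# + y) ≈ x + - y
    [1+x]−[1+y]≈x−y x y = begin
      (1# + x) + - (1# + y)   ≈⟨ +-congˡ (sym (-‿+-comm 1# y)) ⟩
      (1# + x) + (- 1# + - y) ≈⟨ +-assoc 1# x _ ⟩
      1# + (x + (- 1# + - y)) ≈⟨ +-congˡ (sym (+-assoc x (- 1#) (- y))) ⟩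
      1# + ((x + - 1#) + - y) ≈⟨ +-congˡ (+-congʳ (+-comm x (- 1#))) ⟩
      1# + ((- 1# + x) + - y) ≈⟨ +-congˡ (+-assoc (- 1#) x (- y)) ⟩
      1# + (- 1# + (x + - y)) ≈⟨ sym (+-assoc 1# (- 1#) _) ⟩
      (1# + - 1#) + (x + - y) ≈⟨ +-congʳ (-‿inverseʳ 1#) ⟩
      0# + (x + - y)          ≈⟨ +-identityˡ _ ⟩
      x + - y                 ∎

    ⟦⊖⟧ : ∀ m n → ⟦ m ℤ.⊖ n ⟧ℤ ≈ m × 1# + - (n × 1#)
    ⟦⊖⟧ zero    zero    = sym (trans (+-congˡ -0#≈0#) (+-identityʳ 0#))
    ⟦⊖⟧ zero    (suc n) = sym (+-identityˡ _)
    ⟦⊖⟧ (suc m) zero    = sym (trans (+-congˡ -0#≈0#) (+-identityʳ _))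
    ⟦⊖⟧ (suc m) (suc n) rewrite ℤ.[1+m]⊖[1+n]≡m⊖n m n =
      trans (⟦⊖⟧ m n) (sym ([1+x]−[1+y]≈x−y (m × 1#) (n × 1#)))

    ⟦+◃⟧ : ∀ k → ⟦ Sign.+ ℤ.◃ k ⟧ℤ ≈ k × 1#
    ⟦+◃⟧ zero    = refl
    ⟦+◃⟧ (suc k) = refl

    ⟦-◃⟧ : ∀ k → ⟦ Sign.- ℤ.◃ k ⟧ℤ ≈ - (k × 1#)
    ⟦-◃⟧ zero    = sym -0#≈0#
    ⟦-◃⟧ (suc k) = refl

  ⟦-⟧ : ∀ i → ⟦ ℤ.- i ⟧ℤ ≈ - ⟦ i ⟧ℤ
  ⟦-⟧ (ℤ.+ zero)  = sym -0#≈0#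
  ⟦-⟧ (ℤ.+ suc n) = refl
  ⟦-⟧ ℤ.-[1+ n ]  = sym (-‿involutive _)

  ⟦+⟧ : ∀ i j → ⟦ i ℤ.+ j ⟧ℤ ≈ ⟦ i ⟧ℤ + ⟦ j ⟧ℤ
  ⟦+⟧ (ℤ.+ m)    (ℤ.+ n)    = ×-homo-+ 1# m n
  ⟦+⟧ (ℤ.+ m)    ℤ.-[1+ n ] = ⟦⊖⟧ m (suc n)
  ⟦+⟧ ℤ.-[1+ m ] (ℤ.+ n)    = trans (⟦⊖⟧ n (suc m)) (+-comm _ _)
  ⟦+⟧ ℤ.-[1+ m ] ℤ.-[1+ n ] = begin
    - (suc (suc (m ℕ.+ n)) × 1#)
      ≈⟨ -‿cong (reflexive (P.cong (_× 1#) (P.sym (ℕ.+-suc (suc m) n)))) ⟩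
    - ((suc m ℕ.+ suc n) × 1#)       ≈⟨ -‿cong (×-homo-+ 1# (suc m) (suc n)) ⟩
    - (suc m × 1# + suc n × 1#)      ≈⟨ sym (-‿+-comm _ _) ⟩
    - (suc m × 1#) + - (suc n × 1#)  ∎

  ⟦*⟧ : ∀ i j → ⟦ i ℤ.* j ⟧ℤ ≈ ⟦ i ⟧ℤ * ⟦ j ⟧ℤ
  ⟦*⟧ (ℤ.+ m) (ℤ.+ n) = trans (⟦+◃⟧ (m ℕ.* n)) (×1-homo-* m n)
  ⟦*⟧ (ℤ.+ m) ℤ.-[1+ n ] =
    trans (⟦-◃⟧ (m ℕ.* suc n)) (trans (-‿cong (×1-homo-* m (suc n))) (-‿distribʳ-* _ _))
  ⟦*⟧ ℤ.-[1+ m ] (ℤ.+ n) =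
    trans (⟦-◃⟧ (suc m ℕ.* n)) (trans (-‿cong (×1-homo-* (suc m) n)) (-‿distribˡ-* _ _))
  ⟦*⟧ ℤ.-[1+ m ] ℤ.-[1+ n ] = begin
    ⟦ Sign.+ ℤ.◃ (suc m ℕ.* suc n) ⟧ℤ ≈⟨ ⟦+◃⟧ (suc m ℕ.* suc n) ⟩
    (suc m ℕ.* suc n) × 1#            ≈⟨ ×1-homo-* (suc m) (suc n) ⟩
    (suc m × 1#) * (suc n × 1#)       ≈⟨ sym negated ⟩
    - (suc m × 1#) * - (suc n × 1#)   ∎
    where
    negated : ∀ {x y} → - x * - y ≈ x * y
    negated {x} {y} =
      trans (sym (-‿distribˡ-* x (- y))) (trans (-‿cong (sym (-‿distribʳ-* x y))) (-‿involutive _))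

  ring⁺ : AlmostCommutativeRing c ℓ
  ring⁺ = fromCommutativeRing R

  ⟦⟧-morphism : ℤ.+-*-rawRing -Raw-AlmostCommutative⟶ ring⁺
  ⟦⟧-morphism = record
    { ⟦_⟧    = ⟦_⟧ℤ
    ; +-homo = ⟦+⟧
    ; *-homo = ⟦*⟧
    ; -‿homo = ⟦-⟧
    ; 0-homo = refl
    ; 1-homo = +-identityʳ 1#
    }

  ⟦⟧-weaklyDecidable : ∀ i j → Maybe (⟦ i ⟧ℤ ≈ ⟦ j ⟧ℤ)
  ⟦⟧-weaklyDecidable i j with i ℤ.≟ j
  ... | yes P.refl = just refl
  ... | no _       = nothing

  open import Algebra.Solver.Ring ℤ.+-*-rawRing ring⁺ ⟦⟧-morphism ⟦⟧-weaklyDecidable public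

module FieldProperties {α β : Level} (F : Field α β) where
  open Field F
  open FieldOps F
  open IntegerCoefficientSolver commutativeRing using (solve; _:*_; _:-_; _:=_)
  open import Relation.Binary.Reasoning.Setoid setoid
  open import Algebra.Properties.Ring ring using (-‿involutive; -0#≈0#)

  ⁻¹-inverseʳ : ∀ {x} → NonZero x → x * x ⁻¹ ≈ 1#
  ⁻¹-inverseʳ {x} = ⁻¹-inverse x

  ⁻¹-inverseˡ : ∀ {x} → NonZero x → x ⁻¹ * x ≈ 1#
  ⁻¹-inverseˡ x≉0 = trans (*-comm _ _) (⁻¹-inverseʳ x≉0)

  x*[y*y⁻¹]≈x : ∀ {y} → NonZero y → ∀ x → x * (y * y ⁻¹) ≈ x
  x*[y*y⁻¹]≈x y≉0 x = trans (*-congˡ (⁻¹-inverseʳ y≉0)) (*-identityʳ x)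

  x≈1⇒x*[y*y⁻¹]≈1 : ∀ {x y} → x ≈ 1# → NonZero y → x * (y * y ⁻¹) ≈ 1#
  x≈1⇒x*[y*y⁻¹]≈1 x≈1 y≉0 = trans (x*[y*y⁻¹]≈x y≉0 _) x≈1

  *-cancelˡ : ∀ {x y z} → NonZero x → x * y ≈ x * z → y ≈ z
  *-cancelˡ {x} {y} {z} x≉0 eq = begin
    y                ≈⟨ sym (*-identityˡ y) ⟩
    1# * y           ≈⟨ *-congʳ (sym (⁻¹-inverseˡ x≉0)) ⟩
    (x ⁻¹ * x) * y   ≈⟨ *-assoc _ _ _ ⟩
    x ⁻¹ * (x * y)   ≈⟨ *-congˡ eq ⟩
    x ⁻¹ * (x * z)   ≈⟨ sym (*-assoc _ _ _) ⟩
    (x ⁻¹ * x) * z   ≈⟨ *-congʳ (⁻¹-inverseˡ x≉0) ⟩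
    1# * z           ≈⟨ *-identityˡ z ⟩
    z                ∎

  *-cancelʳ : ∀ {x y z} → NonZero x → y * x ≈ z * x → y ≈ z
  *-cancelʳ x≉0 eq = *-cancelˡ x≉0 (trans (*-comm _ _) (trans eq (*-comm _ _)))

  x*y≈0⇒y≈0 : ∀ {x y} → NonZero x → x * y ≈ 0# → y ≈ 0#
  x*y≈0⇒y≈0 {x} x≉0 eq = *-cancelˡ x≉0 (trans eq (sym (zeroʳ x)))

  nonZero-cong : ∀ {x y} → x ≈ y → NonZero x → NonZero y
  nonZero-cong x≈y x≉0 y≈0 = x≉0 (trans x≈y y≈0)

  nonZero-1 : NonZero 1#
  nonZero-1 1≈0 = 0≉1 (sym 1≈0)

  nonZero-* : ∀ {x y} → NonZero x → NonZero y → NonZero (x * y)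
  nonZero-* {x} x≉0 y≉0 xy≈0 = y≉0 (x*y≈0⇒y≈0 x≉0 xy≈0)

  nonZeroˡ : ∀ {x y} → NonZero (x * y) → NonZero x
  nonZeroˡ {y = y} xy≉0 x≈0 = xy≉0 (trans (*-congʳ x≈0) (zeroˡ y))

  nonZeroʳ : ∀ {x y} → NonZero (x * y) → NonZero y
  nonZeroʳ {x} xy≉0 y≈0 = xy≉0 (trans (*-congˡ y≈0) (zeroʳ x))

  nonZero-⁻¹ : ∀ {x} → NonZero x → NonZero (x ⁻¹)
  nonZero-⁻¹ {x} x≉0 x⁻¹≈0 =
    0≉1 (trans (sym (zeroʳ x)) (trans (*-congˡ (sym x⁻¹≈0)) (⁻¹-inverseʳ x≉0)))

  nonZero-negate : ∀ {x} → NonZero x → NonZero (- x)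
  nonZero-negate {x} x≉0 -x≈0 =
    x≉0 (trans (sym (-‿involutive x)) (trans (-‿cong -x≈0) -0#≈0#))

  nonZero-^ : ∀ {x} n → NonZero x → NonZero (x ^ n)
  nonZero-^ zero    x≉0 = nonZero-1
  nonZero-^ (suc n) x≉0 = nonZero-* (nonZero-^ n x≉0) x≉0

  ⁻¹-unique : ∀ {x y} → NonZero x → x * y ≈ 1# → y ≈ x ⁻¹
  ⁻¹-unique x≉0 xy≈1 = *-cancelˡ x≉0 (trans xy≈1 (sym (⁻¹-inverseʳ x≉0)))

  ⁻¹-cong : ∀ {x y} → NonZero x → x ≈ y → x ⁻¹ ≈ y ⁻¹
  ⁻¹-cong x≉0 x≈y =
    ⁻¹-unique (nonZero-cong x≈y x≉0) (trans (*-congʳ (sym x≈y)) (⁻¹-inverseʳ x≉0))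

  ⁻¹-involutive : ∀ {x} → NonZero x → (x ⁻¹) ⁻¹ ≈ x
  ⁻¹-involutive x≉0 = sym (⁻¹-unique (nonZero-⁻¹ x≉0) (⁻¹-inverseˡ x≉0))

  1⁻¹≈1 : 1# ⁻¹ ≈ 1#
  1⁻¹≈1 = sym (⁻¹-unique nonZero-1 (*-identityˡ 1#))

  ⁻¹-distrib-* : ∀ {x y} → NonZero x → NonZero y → (x * y) ⁻¹ ≈ x ⁻¹ * y ⁻¹
  ⁻¹-distrib-* {x} {y} x≉0 y≉0 = sym (⁻¹-unique (nonZero-* x≉0 y≉0) (begin
    (x * y) * (x ⁻¹ * y ⁻¹) ≈⟨ solve 4 (λ x y u v → (x :* y) :* (u :* v) := (x :* u) :* (y :* v))
                                       refl x y (x ⁻¹) (y ⁻¹) ⟩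
    (x * x ⁻¹) * (y * y ⁻¹) ≈⟨ x*[y*y⁻¹]≈x y≉0 _ ⟩
    x * x ⁻¹                ≈⟨ ⁻¹-inverseʳ x≉0 ⟩
    1#                      ∎))

  ⁻¹-distrib-*³ : ∀ {x y z} → NonZero x → NonZero y → NonZero z →
                  (x * y * z) ⁻¹ ≈ x ⁻¹ * y ⁻¹ * z ⁻¹
  ⁻¹-distrib-*³ x≉0 y≉0 z≉0 =
    trans (⁻¹-distrib-* (nonZero-* x≉0 y≉0) z≉0) (*-congʳ (⁻¹-distrib-* x≉0 y≉0))

  ⁻¹-distrib-*⁴ : ∀ {x y z w} → NonZero x → NonZero y → NonZero z → NonZero w →
                  (x * y * z * w) ⁻¹ ≈ x ⁻¹ * y ⁻¹ * z ⁻¹ * w ⁻¹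
  ⁻¹-distrib-*⁴ x≉0 y≉0 z≉0 w≉0 =
    trans (⁻¹-distrib-* (nonZero-* (nonZero-* x≉0 y≉0) z≉0) w≉0)
          (*-congʳ (⁻¹-distrib-*³ x≉0 y≉0 z≉0))

  ⁻¹-distrib-*⁵ : ∀ {x y z w v} → NonZero x → NonZero y → NonZero z → NonZero w → NonZero v →
                  (x * y * z * w * v) ⁻¹ ≈ x ⁻¹ * y ⁻¹ * z ⁻¹ * w ⁻¹ * v ⁻¹
  ⁻¹-distrib-*⁵ x≉0 y≉0 z≉0 w≉0 v≉0 =
    trans (⁻¹-distrib-* (nonZero-* (nonZero-* (nonZero-* x≉0 y≉0) z≉0) w≉0) v≉0)
          (*-congʳ (⁻¹-distrib-*⁴ x≉0 y≉0 z≉0 w≉0))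

  1−-cong : ∀ {x y} → x ≈ y → 1# − x ≈ 1# − y
  1−-cong x≈y = +-congˡ (-‿cong x≈y)

  1−x/y≈[y−x]/y : ∀ {y} → NonZero y → ∀ x → 1# − x / y ≈ (y − x) / y
  1−x/y≈[y−x]/y {y} y≉0 x = begin
    1# − x / y       ≈⟨ +-congʳ (sym (⁻¹-inverseʳ y≉0)) ⟩
    y / y − x / y    ≈⟨ solve 3 (λ y x i → y :* i :- x :* i := (y :- x) :* i) refl y x (y ⁻¹) ⟩
    (y − x) / y      ∎

  [x*y]/[x*z]≈y/z : ∀ {x y z} → NonZero x → NonZero z → (x * y) / (x * z) ≈ y / z
  [x*y]/[x*z]≈y/z {x} {y} {z} x≉0 z≉0 = begin
    (x * y) / (x * z)           ≈⟨ *-congˡ (⁻¹-distrib-* x≉0 z≉0) ⟩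
    (x * y) * (x ⁻¹ * z ⁻¹)     ≈⟨ solve 4 (λ x y u v → (x :* y) :* (u :* v) := (y :* v) :* (x :* u))
                                           refl x y (x ⁻¹) (z ⁻¹) ⟩
    (y / z) * (x * x ⁻¹)        ≈⟨ x*[y*y⁻¹]≈x x≉0 _ ⟩
    y / z                       ∎

  x*z/[y*z]≈x/y : ∀ {y z} → NonZero y → NonZero z → ∀ x → x * z / (y * z) ≈ x / y
  x*z/[y*z]≈x/y {y} {z} y≉0 z≉0 x = begin
    x * z / (y * z)          ≈⟨ *-congˡ (⁻¹-distrib-* y≉0 z≉0) ⟩
    x * z * (y ⁻¹ * z ⁻¹)    ≈⟨ solve 4 (λ x z u v → x :* z :* (u :* v) := (x :* u) :* (z :* v))
                                        refl x z (y ⁻¹) (z ⁻¹) ⟩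
    (x / y) * (z * z ⁻¹)     ≈⟨ x*[y*y⁻¹]≈x z≉0 _ ⟩
    x / y                    ∎

  x/[y*z]*z≈x/y : ∀ {y z} → NonZero y → NonZero z → ∀ x → x / (y * z) * z ≈ x / y
  x/[y*z]*z≈x/y {y} {z} y≉0 z≉0 x = begin
    x / (y * z) * z            ≈⟨ *-congʳ (*-congˡ (⁻¹-distrib-* y≉0 z≉0)) ⟩
    x * (y ⁻¹ * z ⁻¹) * z      ≈⟨ solve 4 (λ x u v z → x :* (u :* v) :* z := (x :* u) :* (z :* v))
                                          refl x (y ⁻¹) (z ⁻¹) z ⟩
    (x / y) * (z * z ⁻¹)       ≈⟨ x*[y*y⁻¹]≈x z≉0 _ ⟩
    x / y                      ∎

  [x/y]*w≈x*z : ∀ {x y z w} → NonZero y → w ≈ y * z → (x / y) * w ≈ x * z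
  [x/y]*w≈x*z {x} {y} {z} {w} y≉0 w≈yz = begin
    (x / y) * w          ≈⟨ *-congˡ w≈yz ⟩
    (x / y) * (y * z)    ≈⟨ solve 4 (λ x u y z → (x :* u) :* (y :* z) := (x :* z) :* (y :* u))
                                    refl x (y ⁻¹) y z ⟩
    (x * z) * (y * y ⁻¹) ≈⟨ x*[y*y⁻¹]≈x y≉0 _ ⟩
    x * z                ∎

  x*y≈z⇒x≈z/y : ∀ {x y z} → NonZero y → x * y ≈ z → x ≈ z / y
  x*y≈z⇒x≈z/y {x} {y} {z} y≉0 xy≈z = begin
    x                  ≈⟨ sym (x*[y*y⁻¹]≈x y≉0 x) ⟩
    x * (y * y ⁻¹)     ≈⟨ sym (*-assoc _ _ _) ⟩
    x * y * y ⁻¹       ≈⟨ *-congʳ xy≈z ⟩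
    z / y              ∎

  /-cross : ∀ {x y u v} → NonZero y → NonZero v → x * y ≈ u * v → x / v ≈ u / y
  /-cross {x} {y} {u} {v} y≉0 v≉0 xy≈uv = begin
    x / v                 ≈⟨ sym (x*[y*y⁻¹]≈x y≉0 _) ⟩
    x / v * (y * y ⁻¹)    ≈⟨ solve 4 (λ x i y j → x :* i :* (y :* j) := (x :* y) :* i :* j)
                                     refl x (v ⁻¹) y (y ⁻¹) ⟩
    (x * y) / v / y       ≈⟨ *-congʳ (*-congʳ xy≈uv) ⟩
    (u * v) / v / y       ≈⟨ solve 4 (λ u v i j → (u :* v) :* i :* j := u :* j :* (v :* i))
                                     refl u v (v ⁻¹) (y ⁻¹) ⟩
    u / y * (v * v ⁻¹)    ≈⟨ x*[y*y⁻¹]≈x v≉0 _ ⟩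
    u / y                 ∎

  ^-cong : ∀ {x y} n → x ≈ y → x ^ n ≈ y ^ n
  ^-cong zero    x≈y = refl
  ^-cong (suc n) x≈y = *-cong (^-cong n x≈y) x≈y

  ^-distribˡ-+-* : ∀ x m n → x ^ (m ℕ.+ n) ≈ x ^ m * x ^ n
  ^-distribˡ-+-* x m zero rewrite ℕ.+-identityʳ m = sym (*-identityʳ _)
  ^-distribˡ-+-* x m (suc n) rewrite ℕ.+-suc m n =
    trans (*-congʳ (^-distribˡ-+-* x m n)) (*-assoc _ _ _)

  ^-*-assoc : ∀ x m n → (x ^ m) ^ n ≈ x ^ (m *ℕ n)
  ^-*-assoc x m zero rewrite ℕ.*-zeroʳ m = refl
  ^-*-assoc x m (suc n) rewrite ℕ.*-suc m n =
    sym (trans (^-distribˡ-+-* x m (m *ℕ n)) (trans (*-comm _ _) (*-congʳ (sym (^-*-assoc x m n)))))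

  ^-distribʳ-* : ∀ x y n → (x * y) ^ n ≈ x ^ n * y ^ n
  ^-distribʳ-* x y zero    = sym (*-identityˡ 1#)
  ^-distribʳ-* x y (suc n) =
    trans (*-congʳ (^-distribʳ-* x y n))
          (solve 4 (λ a b c d → (a :* b) :* (c :* d) := (a :* c) :* (b :* d)) refl (x ^ n) (y ^ n) x y)

  1^n≈1 : ∀ n → 1# ^ n ≈ 1#
  1^n≈1 zero    = refl
  1^n≈1 (suc n) = trans (*-identityʳ _) (1^n≈1 n)

  x^1≈x : ∀ x → x ^ 1 ≈ x
  x^1≈x = *-identityˡ

  x^2≈x*x : ∀ x → x ^ 2 ≈ x * x
  x^2≈x*x x = *-congʳ (x^1≈x x)

  x^3≈x*x*x : ∀ x → x ^ 3 ≈ x * x * x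
  x^3≈x*x*x x = *-congʳ (x^2≈x*x x)

  x^[2*n]≈x^n*x^n : ∀ x n → x ^ (2 *ℕ n) ≈ x ^ n * x ^ n
  x^[2*n]≈x^n*x^n x n =
    trans (^-distribˡ-+-* x n (n ℕ.+ 0)) (*-congˡ (reflexive (P.cong (x ^_) (ℕ.+-identityʳ n))))

  [x^3]^n≈x^n*x^n*x^n : ∀ x n → (x ^ 3) ^ n ≈ x ^ n * x ^ n * x ^ n
  [x^3]^n≈x^n*x^n*x^n x n = begin
    (x ^ 3) ^ n  ≈⟨ ^-*-assoc x 3 n ⟩
    x ^ (3 *ℕ n) ≡⟨ P.cong (x ^_) (ℕ.*-comm 3 n) ⟩
    x ^ (n *ℕ 3) ≈⟨ sym (^-*-assoc x n 3) ⟩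
    (x ^ n) ^ 3  ≈⟨ x^3≈x*x*x (x ^ n) ⟩
    x ^ n * x ^ n * x ^ n ∎

module Summation {α β : Level} (F : Field α β) where
  open Field F
  open FieldOps F
  open IntegerCoefficientSolver commutativeRing using (solve; _:+_; _:-_; _:=_)
  open import Relation.Binary.Reasoning.Setoid setoid
  open import Algebra.Properties.Ring ring using (-0#≈0#)

  sumTo-cong : ∀ n {f g : ℕ → Carrier} → (∀ i → i < n → f i ≈ g i) → sumTo n f ≈ sumTo n g
  sumTo-cong zero    f≈g = refl
  sumTo-cong (suc n) f≈g =
    +-cong (sumTo-cong n (λ i i<n → f≈g i (ℕ.m<n⇒m<1+n i<n))) (f≈g n (ℕ.n<1+n n))

  sumTo-zero : ∀ n → sumTo n (λ _ → 0#) ≈ 0#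
  sumTo-zero zero    = refl
  sumTo-zero (suc n) = trans (+-identityʳ _) (sumTo-zero n)

  sumTo-distribʳ : ∀ n (f : ℕ → Carrier) x → sumTo n f * x ≈ sumTo n (λ i → f i * x)
  sumTo-distribʳ zero    f x = zeroˡ x
  sumTo-distribʳ (suc n) f x = trans (distribʳ x _ _) (+-congʳ (sumTo-distribʳ n f x))

  sumTo-distribˡ : ∀ n (f : ℕ → Carrier) x → x * sumTo n f ≈ sumTo n (λ i → x * f i)
  sumTo-distribˡ zero    f x = zeroʳ x
  sumTo-distribˡ (suc n) f x = trans (distribˡ x _ _) (+-congʳ (sumTo-distribˡ n f x))

  sumTo-+ : ∀ n (f g : ℕ → Carrier) → sumTo n f + sumTo n g ≈ sumTo n (λ i → f i + g i)
  sumTo-+ zero    f g = +-identityʳ 0#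
  sumTo-+ (suc n) f g =
    trans (solve 4 (λ s a t b → s :+ a :+ (t :+ b) := s :+ t :+ (a :+ b)) refl
                   (sumTo n f) (f n) (sumTo n g) (g n))
          (+-congʳ (sumTo-+ n f g))

  sumTo-− : ∀ n (f g : ℕ → Carrier) → sumTo n f − sumTo n g ≈ sumTo n (λ i → f i − g i)
  sumTo-− zero    f g = trans (+-congˡ -0#≈0#) (+-identityʳ 0#)
  sumTo-− (suc n) f g =
    trans (solve 4 (λ s a t b → s :+ a :- (t :+ b) := s :- t :+ (a :- b)) refl
                   (sumTo n f) (f n) (sumTo n g) (g n))
          (+-congʳ (sumTo-− n f g))

  sumTo-telescope : ∀ (h : ℕ → Carrier) m → sumTo m (λ j → h j − h (suc j)) ≈ h 0 − h m
  sumTo-telescope h zero    = sym (-‿inverseʳ (h 0))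
  sumTo-telescope h (suc m) =
    trans (+-congʳ (sumTo-telescope h m))
          (solve 3 (λ a b c → a :- b :+ (b :- c) := a :- c) refl (h 0) (h m) (h (suc m)))

  sumTo-double-telescope :
    ∀ (f g : ℕ → ℕ → Carrier) n m →
    (∀ k j → k < n → j < m → f k j − f k (suc j) ≈ g k j − g (suc k) j) →
    sumTo n (λ k → f k 0 − f k m) ≈ sumTo m (λ j → g 0 j − g n j)
  sumTo-double-telescope f g zero m _ =
    sym (trans (sumTo-cong m (λ j _ → -‿inverseʳ (g 0 j))) (sumTo-zero m))
  sumTo-double-telescope f g (suc n) m f≈g = begin
    sumTo n (λ k → f k 0 − f k m) + (f n 0 − f n m)
      ≈⟨ +-cong (sumTo-double-telescope f g n m (λ k j k<n → f≈g k j (ℕ.m<n⇒m<1+n k<n)))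
                (sym (sumTo-telescope (f n) m)) ⟩
    sumTo m (λ j → g 0 j − g n j) + sumTo m (λ j → f n j − f n (suc j))
      ≈⟨ +-congˡ (sumTo-cong m (λ j → f≈g n j (ℕ.n<1+n n))) ⟩
    sumTo m (λ j → g 0 j − g n j) + sumTo m (λ j → g n j − g (suc n) j)
      ≈⟨ sumTo-+ m _ _ ⟩
    sumTo m (λ j → (g 0 j − g n j) + (g n j − g (suc n) j))
      ≈⟨ sumTo-cong m (λ j _ → solve 3 (λ a b c → a :- b :+ (b :- c) := a :- c) refl
                                       (g 0 j) (g n j) (g (suc n) j)) ⟩
    sumTo m (λ j → g 0 j − g (suc n) j) ∎

module Pochhammer {α β : Level} (F : Field α β) where
  open Field F
  open FieldOps F
  open FieldProperties F
  open IntegerCoefficientSolver commutativeRing using (solve; _:*_; _:-_; :-_; _:=_)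
  open import Relation.Binary.Reasoning.Setoid setoid

  poch-cong : ∀ {x y} p n → x ≈ y → poch x p n ≈ poch y p n
  poch-cong p zero    x≈y = refl
  poch-cong p (suc n) x≈y = *-cong (poch-cong p n x≈y) (1−-cong (*-congʳ x≈y))

  poch-+ : ∀ x p u v → poch x p (u ℕ.+ v) ≈ poch x p u * poch (x * p ^ u) p v
  poch-+ x p u zero rewrite ℕ.+-identityʳ u = sym (*-identityʳ _)
  poch-+ x p u (suc v) rewrite ℕ.+-suc u v = begin
    poch x p (u ℕ.+ v) * (1# − x * p ^ (u ℕ.+ v))
      ≈⟨ *-cong (poch-+ x p u v) (1−-cong (trans (*-congˡ (^-distribˡ-+-* p u v)) (sym (*-assoc _ _ _)))) ⟩
    poch x p u * poch (x * p ^ u) p v * (1# − x * p ^ u * p ^ v)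
      ≈⟨ *-assoc _ _ _ ⟩
    poch x p u * (poch (x * p ^ u) p v * (1# − x * p ^ u * p ^ v)) ∎

  poch-sucˡ : ∀ x p n → poch x p (suc n) ≈ (1# − x) * poch (x * p) p n
  poch-sucˡ x p n = trans (poch-+ x p 1 n)
    (*-cong (trans (*-identityˡ _) (1−-cong (*-identityʳ x))) (poch-cong p n (*-congˡ (x^1≈x p))))

  poch-shift : ∀ x p n → poch (x * p) p n * (1# − x) ≈ poch x p n * (1# − x * p ^ n)
  poch-shift x p n = trans (*-comm _ _) (sym (poch-sucˡ x p n))

  nonZero-poch-≤ : ∀ {x p u n} → u ≤ n → NonZero (poch x p n) → NonZero (poch x p u)
  nonZero-poch-≤ u≤n = go (ℕ.≤⇒≤′ u≤n)
    where
    go : ∀ {x p u n} → u ℕ.≤′ n → NonZero (poch x p n) → NonZero (poch x p u)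
    go ℕ.≤′-refl        nz = nz
    go (ℕ.≤′-step u≤′n) nz = go u≤′n (nonZeroˡ nz)

  nonZero-poch-factor : ∀ {x p k n} → k < n → NonZero (poch x p n) → NonZero (1# − x * p ^ k)
  nonZero-poch-factor k<n nz = nonZeroʳ (nonZero-poch-≤ k<n nz)

  module Base (q : Carrier) (q≉0 : NonZero q) where

    q^≉0 : ∀ n → NonZero (q ^ n)
    q^≉0 n = nonZero-^ n q≉0

    -- reversalFactor x n = (−1/x)ⁿ q^(n(n−1)/2)
    reversalFactor : Carrier → ℕ → Carrier
    reversalFactor x zero    = 1#
    reversalFactor x (suc n) = reversalFactor x n * (- (q ^ n / x))

    reversalFactor-cong : ∀ {x y} → NonZero x → x ≈ y → ∀ n → reversalFactor x n ≈ reversalFactor y n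
    reversalFactor-cong x≉0 x≈y zero    = refl
    reversalFactor-cong x≉0 x≈y (suc n) =
      *-cong (reversalFactor-cong x≉0 x≈y n) (-‿cong (*-congˡ (⁻¹-cong x≉0 x≈y)))

    reversalFactor-scale : ∀ {x z} → NonZero x → NonZero z → ∀ n →
                           reversalFactor x n ≈ reversalFactor (x * z) n * z ^ n
    reversalFactor-scale x≉0 z≉0 zero = sym (*-identityˡ 1#)
    reversalFactor-scale {x} {z} x≉0 z≉0 (suc n) = begin
      R x n * (- (q ^ n * x ⁻¹))
        ≈⟨ *-congʳ (reversalFactor-scale x≉0 z≉0 n) ⟩
      R (x * z) n * z ^ n * (- (q ^ n * x ⁻¹))
        ≈⟨ *-congˡ (-‿cong (*-congˡ (sym (x*[y*y⁻¹]≈x z≉0 (x ⁻¹))))) ⟩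
      R (x * z) n * z ^ n * (- (q ^ n * (x ⁻¹ * (z * z ⁻¹))))
        ≈⟨ solve 6 (λ r w a xi zz zi → r :* w :* (:- (a :* (xi :* (zz :* zi))))
                                    := r :* (:- (a :* (xi :* zi))) :* (w :* zz))
                   refl (R (x * z) n) (z ^ n) (q ^ n) (x ⁻¹) z (z ⁻¹) ⟩
      R (x * z) n * (- (q ^ n * (x ⁻¹ * z ⁻¹))) * (z ^ n * z)
        ≈⟨ *-congʳ (*-congˡ (-‿cong (*-congˡ (sym (⁻¹-distrib-* x≉0 z≉0))))) ⟩
      R (x * z) n * (- (q ^ n * (x * z) ⁻¹)) * (z ^ n * z) ∎
      where R = reversalFactor

    -- Read the factors of (1/x;q)ₙ in reverse order.
    poch-reverse : ∀ {x} → NonZero x → ∀ n →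
                   poch (1# / x) q n ≈ reversalFactor x n * poch (x * q / q ^ n) q n
    poch-reverse x≉0 zero = sym (*-identityˡ 1#)
    poch-reverse {x} x≉0 (suc n) = begin
      poch (1# / x) q n * (1# − 1# / x * q ^ n)
        ≈⟨ *-congʳ (poch-reverse x≉0 n) ⟩
      R n * poch (x * q / q ^ n) q n * (1# − 1# / x * q ^ n)
        ≈⟨ *-congʳ (*-congˡ (poch-cong q n (sym (x/[y*z]*z≈x/y (q^≉0 n) q≉0 (x * q))))) ⟩
      R n * poch (y * q) q n * (1# − 1# / x * q ^ n)
        ≈⟨ *-congˡ (sym newFactor) ⟩
      R n * poch (y * q) q n * (- (q ^ n / x) * (1# − y))
        ≈⟨ solve 4 (λ r p a b → r :* p :* (a :* b) := r :* a :* (b :* p))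
                   refl (R n) (poch (y * q) q n) (- (q ^ n / x)) (1# − y) ⟩
      R n * (- (q ^ n / x)) * ((1# − y) * poch (y * q) q n)
        ≈⟨ *-congˡ (sym (poch-sucˡ y q n)) ⟩
      R (suc n) * poch y q (suc n) ∎
      where
      R = reversalFactor x
      y = x * q / q ^ suc n
      A = q ^ n
      newFactor : - (A / x) * (1# − y) ≈ 1# − 1# / x * A
      newFactor = begin
        - (A * x ⁻¹) * (1# − y)
          ≈⟨ *-congˡ (1−-cong (x*z/[y*z]≈x/y (q^≉0 n) q≉0 x)) ⟩
        - (A * x ⁻¹) * (1# − x * A ⁻¹)
          ≈⟨ solve 5 (λ a xi x ai o → :- (a :* xi) :* (o :- x :* ai)
                                   := (a :* ai) :* (x :* xi) :- o :* xi :* a)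
                     refl A (x ⁻¹) x (A ⁻¹) 1# ⟩
        (A * A ⁻¹) * (x * x ⁻¹) − 1# * x ⁻¹ * A
          ≈⟨ +-congʳ (trans (x*[y*y⁻¹]≈x x≉0 _) (⁻¹-inverseʳ (q^≉0 n))) ⟩
        1# − 1# * x ⁻¹ * A ∎

    -- pochRatio x u v is the quotient (x q^(−v);q)ᵥ / (x q^(−v);q)ᵤ, with the common
    -- factors cancelled, so that it is defined without any non-vanishing hypothesis.
    pochRatio : Carrier → ℕ → ℕ → Carrier
    pochRatio x u       zero    = (poch x q u) ⁻¹
    pochRatio x zero    (suc v) = poch (x / q ^ suc v) q (suc v)
    pochRatio x (suc u) (suc v) = pochRatio x u v

    poch/poch≈pochRatio : ∀ x u v z → z * q ^ v ≈ x → NonZero (poch z q u) →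
                          poch z q v / poch z q u ≈ pochRatio x u v
    poch/poch≈pochRatio x u zero z zq^v≈x nz =
      trans (*-identityˡ _) (⁻¹-cong nz (poch-cong q u (trans (sym (*-identityʳ z)) zq^v≈x)))
    poch/poch≈pochRatio x zero (suc v) z zq^v≈x nz =
      trans (*-congˡ 1⁻¹≈1)
            (trans (*-identityʳ _) (poch-cong q (suc v) (x*y≈z⇒x≈z/y (q^≉0 (suc v)) zq^v≈x)))
    poch/poch≈pochRatio x (suc u) (suc v) z zq^v≈x nz = begin
      poch z q (suc v) / poch z q (suc u)
        ≈⟨ *-cong (poch-sucˡ z q v) (⁻¹-cong nz (poch-sucˡ z q u)) ⟩
      ((1# − z) * poch (z * q) q v) / ((1# − z) * poch (z * q) q u)
        ≈⟨ [x*y]/[x*z]≈y/z (nonZeroˡ nz′) (nonZeroʳ nz′) ⟩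
      poch (z * q) q v / poch (z * q) q u
        ≈⟨ poch/poch≈pochRatio x u v (z * q)
             (trans (*-assoc z q (q ^ v)) (trans (*-congˡ (*-comm q (q ^ v))) zq^v≈x)) (nonZeroʳ nz′) ⟩
      pochRatio x u v ∎
      where nz′ = nonZero-cong (poch-sucˡ z q u) nz

    poch/poch≈pochRatio′ : ∀ x u v w → w * q ^ v ≈ x * q ^ u → NonZero (poch x q u) →
                           poch w q v / poch x q u ≈ pochRatio x u v
    poch/poch≈pochRatio′ x u zero w _ _ = *-identityˡ _
    poch/poch≈pochRatio′ x zero (suc v) w wq^v≈x _ =
      trans (*-congˡ 1⁻¹≈1)
            (trans (*-identityʳ _)
                   (poch-cong q (suc v) (x*y≈z⇒x≈z/y (q^≉0 (suc v)) (trans wq^v≈x (*-identityʳ x)))))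
    poch/poch≈pochRatio′ x (suc u) (suc v) w wq^v≈xq^u nz = begin
      (poch w q v * (1# − w * q ^ v)) / (poch x q u * (1# − x * q ^ u))
        ≈⟨ *-cong (*-comm _ _) (⁻¹-cong nz (*-comm _ _)) ⟩
      ((1# − w * q ^ v) * poch w q v) / ((1# − x * q ^ u) * poch x q u)
        ≈⟨ *-congʳ (*-congʳ (1−-cong lower)) ⟩
      ((1# − x * q ^ u) * poch w q v) / ((1# − x * q ^ u) * poch x q u)
        ≈⟨ [x*y]/[x*z]≈y/z (nonZeroʳ nz) (nonZeroˡ nz) ⟩
      poch w q v / poch x q u
        ≈⟨ poch/poch≈pochRatio′ x u v w lower (nonZeroˡ nz) ⟩
      pochRatio x u v ∎
      where
      lower : w * q ^ v ≈ x * q ^ u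
      lower = *-cancelʳ q≉0 (trans (*-assoc _ _ _) (trans wq^v≈xq^u (sym (*-assoc _ _ _))))

    pochRatio-suc : ∀ x u v → NonZero (poch x q u) →
                    pochRatio x u (suc v) ≈ pochRatio x u v * (1# − x * q ^ u / q ^ suc v)
    pochRatio-suc x zero zero _ = begin
      1# * (1# − x / q ^ 1 * 1#)
        ≈⟨ solve 4 (λ o x i o′ → o :* (o′ :- x :* i :* o) := o :* (o′ :- x :* o :* i))
                   refl 1# x ((q ^ 1) ⁻¹) 1# ⟩
      1# * (1# − x * 1# / q ^ 1)
        ≈⟨ *-congʳ (sym 1⁻¹≈1) ⟩
      1# ⁻¹ * (1# − x * 1# / q ^ 1) ∎
    pochRatio-suc x zero (suc v) _ = begin
      poch (x / q ^ suc (suc v)) q (suc (suc v))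
        ≈⟨ poch-sucˡ (x / q ^ suc (suc v)) q (suc v) ⟩
      (1# − x / q ^ suc (suc v)) * poch (x / q ^ suc (suc v) * q) q (suc v)
        ≈⟨ *-cong (1−-cong (*-congʳ (sym (*-identityʳ x))))
                  (poch-cong q (suc v) (x/[y*z]*z≈x/y (q^≉0 (suc v)) q≉0 x)) ⟩
      (1# − x * 1# / q ^ suc (suc v)) * poch (x / q ^ suc v) q (suc v)
        ≈⟨ *-comm _ _ ⟩
      poch (x / q ^ suc v) q (suc v) * (1# − x * 1# / q ^ suc (suc v)) ∎
    pochRatio-suc x (suc u) zero nz = begin
      (poch x q u) ⁻¹
        ≈⟨ sym (*-identityʳ _) ⟩
      (poch x q u) ⁻¹ * 1#
        ≈⟨ *-congˡ (sym (⁻¹-inverseˡ f≉0)) ⟩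
      (poch x q u) ⁻¹ * (f ⁻¹ * f)
        ≈⟨ sym (*-assoc _ _ _) ⟩
      (poch x q u) ⁻¹ * f ⁻¹ * f
        ≈⟨ *-cong (sym (⁻¹-distrib-* (nonZeroˡ nz) f≉0)) (1−-cong xq^u≈xq^[1+u]/q) ⟩
      (poch x q u * f) ⁻¹ * (1# − x * q ^ suc u / q ^ 1) ∎
      where
      f = 1# − x * q ^ u
      f≉0 = nonZeroʳ nz
      xq^u≈xq^[1+u]/q : x * q ^ u ≈ x * q ^ suc u / q ^ 1
      xq^u≈xq^[1+u]/q = x*y≈z⇒x≈z/y (q^≉0 1) (trans (*-congˡ (x^1≈x q)) (*-assoc x (q ^ u) q))
    pochRatio-suc x (suc u) (suc v) nz = begin
      pochRatio x u (suc v)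
        ≈⟨ pochRatio-suc x u v (nonZeroˡ nz) ⟩
      pochRatio x u v * (1# − x * q ^ u / q ^ suc v)
        ≈⟨ *-congˡ (1−-cong (sym (trans (*-congʳ (sym (*-assoc x (q ^ u) q)))
                                         (x*z/[y*z]≈x/y (q^≉0 (suc v)) q≉0 (x * q ^ u))))) ⟩
      pochRatio x u v * (1# − x * q ^ suc u / q ^ suc (suc v)) ∎

    pochRatio-shift : ∀ x y u v → x * q ≈ y → NonZero (poch x q u) →
                      (1# − x) * pochRatio x u v ≈ pochRatio y u (suc v)
    pochRatio-shift x y zero zero xq≈y _ = begin
      (1# − x) * 1# ⁻¹  ≈⟨ *-congˡ 1⁻¹≈1 ⟩
      (1# − x) * 1#     ≈⟨ *-comm _ _ ⟩
      1# * (1# − x)     ≈⟨ *-congˡ (1−-cong (trans x≈y/q (sym (*-identityʳ _)))) ⟩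
      1# * (1# − y / q ^ 1 * q ^ 0) ∎
      where x≈y/q = x*y≈z⇒x≈z/y (q^≉0 1) (trans (*-congˡ (x^1≈x q)) xq≈y)
    pochRatio-shift x y zero (suc v) xq≈y _ = begin
      (1# − x) * poch (x / q ^ suc v) q (suc v)
        ≈⟨ *-comm _ _ ⟩
      poch (x / q ^ suc v) q (suc v) * (1# − x)
        ≈⟨ *-cong (poch-cong q (suc v) base) (1−-cong x≈) ⟩
      poch (y / q ^ suc (suc v)) q (suc v) * (1# − y / q ^ suc (suc v) * q ^ suc v) ∎
      where
      base : x / q ^ suc v ≈ y / q ^ suc (suc v)
      base = sym (trans (*-congʳ (sym xq≈y)) (x*z/[y*z]≈x/y (q^≉0 (suc v)) q≉0 x))
      x≈ : x ≈ y / q ^ suc (suc v) * q ^ suc v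
      x≈ = begin
        x                                ≈⟨ sym (x*[y*y⁻¹]≈x (q^≉0 (suc v)) x) ⟩
        x * (q ^ suc v * (q ^ suc v) ⁻¹) ≈⟨ solve 3 (λ x a i → x :* (a :* i) := x :* i :* a)
                                                    refl x (q ^ suc v) ((q ^ suc v) ⁻¹) ⟩
        x / q ^ suc v * q ^ suc v        ≈⟨ *-congʳ base ⟩
        y / q ^ suc (suc v) * q ^ suc v  ∎
    pochRatio-shift x y (suc u) zero xq≈y nz = begin
      (1# − x) * (poch x q (suc u)) ⁻¹
        ≈⟨ *-congˡ (⁻¹-cong nz split) ⟩
      (1# − x) * ((1# − x) * poch y q u) ⁻¹
        ≈⟨ *-congˡ (⁻¹-distrib-* (nonZeroˡ nz′) (nonZeroʳ nz′)) ⟩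
      (1# − x) * ((1# − x) ⁻¹ * (poch y q u) ⁻¹)
        ≈⟨ sym (*-assoc _ _ _) ⟩
      (1# − x) * (1# − x) ⁻¹ * (poch y q u) ⁻¹
        ≈⟨ *-congʳ (⁻¹-inverseʳ (nonZeroˡ nz′)) ⟩
      1# * (poch y q u) ⁻¹
        ≈⟨ *-identityˡ _ ⟩
      (poch y q u) ⁻¹ ∎
      where
      split = trans (poch-sucˡ x q u) (*-congˡ (poch-cong q u xq≈y))
      nz′ = nonZero-cong split nz
    pochRatio-shift x y (suc u) (suc v) xq≈y nz = pochRatio-shift x y u v xq≈y (nonZeroˡ nz)

module Certificate {α β : Level} (F : Field α β) (a b c q : Field.Carrier F)
                   (a≉0 : FieldOps.NonZero F a) (b≉0 : FieldOps.NonZero F b)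
                   (c≉0 : FieldOps.NonZero F c) (q≉0 : FieldOps.NonZero F q) where
  open Field F
  open FieldOps F
  open FieldProperties F
  open Pochhammer F
  open Base q q≉0
  open Summation F
  open IntegerCoefficientSolver commutativeRing using (solve; _:+_; _:*_; _:-_; :-_; _:=_; con)
  open import Relation.Binary.Reasoning.Setoid setoid
  open import Algebra.Properties.Ring ring using (-‿distribˡ-*; -‿distribʳ-*)

  -- With pochRatio read as a quotient of q-shifted factorials,
  --   f k j = qᵏ (1/(aq²);q)₂ⱼ (b/q;q)ⱼ₊ₖ (cq^(1−j);q)₂ₖ
  --           / ((aq^(3−2j);q)ₖ (c/(aq);q)ⱼ₊ₖ (bcq²;q³)ₖ (1/c;q)ⱼ (b/(aq³);q³)ⱼ),
  --   g k j = (1−q/(bc)) (1−aq²) qʲ (1/(aq);q)₂ⱼ (b/q;q)ⱼ₊ₖ (cq^(−j);q)₂ₖ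
  --           / ((aq^(2−2j);q)ₖ (1−aq³/b) (c/(aq);q)ⱼ₊ₖ (b/a;q³)ⱼ (bc/q;q³)ₖ (1/c;q)ⱼ₊₁).
  f : ℕ → ℕ → Carrier
  f k j = q ^ k * reversalFactor (a * q ^ 2) (2 *ℕ j) * pochRatio (a * q ^ 3) k (2 *ℕ j)
          * poch (b / q) q (j ℕ.+ k) * poch (c / q ^ j * q) q (2 *ℕ k)
          / (poch (c / (a * q)) q (j ℕ.+ k) * poch (b * c * q ^ 2) (q ^ 3) k * poch (1# / c) q j
             * poch (b / (a * q ^ 3)) (q ^ 3) j)

  g-with : ℕ → ℕ → ℕ → ℕ → Carrier
  g-with k j s t =
    (1# − q / (b * c)) * q ^ j * reversalFactor (a * q) (2 *ℕ j) * pochRatio (a * q ^ 3) k (suc (2 *ℕ j))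
    * poch (b / q) q s * poch (c / q ^ j) q t
    / ((1# − a * q ^ 3 / b) * poch (c / (a * q)) q s * poch (b / a) (q ^ 3) j
       * poch (b * c / q) (q ^ 3) k * poch (1# / c) q (suc j))

  g : ℕ → ℕ → Carrier
  g k j = g-with k j (j ℕ.+ k) (2 *ℕ k)

  commonDenominator : ℕ → ℕ → Carrier
  commonDenominator k j =
    (1# − a * q ^ 3 / b) * poch (c / (a * q)) q (suc (j ℕ.+ k)) * poch (b * c / q) (q ^ 3) (suc k)
    * poch (1# / c) q (suc j) * poch (b / (a * q ^ 3)) (q ^ 3) (suc j) * (1# − c / q ^ j)

  -- After clearing denominators, f k j − f k (j+1) = g k j − g (k+1) j is the polynomial
  -- identity P₁ − P₂ − P₃ + P₄ = 0 in a, b, c, q and X = qᵏ, Y = qʲ.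
  P₁ P₂ P₃ P₄ : Carrier → Carrier → Carrier
  P₁ X Y = X * (b − a * (q * q * q)) * (a * q − c * (Y * X)) * (q − b * c) * (c − Y)
           * (a * (q * q * q) − b * (Y * Y * Y)) * (Y − c * (X * X))
           * (q * q * q * q * (Y * Y * Y * Y))
  P₂ X Y = X * (- (Y * Y)) * (- (Y * Y * q)) * (Y * Y * q − a * (q * q * q) * X)
           * (Y * Y * q * q − a * (q * q * q) * X) * (q − b * (Y * X)) * (b − a * (q * q * q))
           * (q − b * c) * (Y − c)
           * c
  P₃ X Y = (b * c − q) * (Y * (Y * Y)) * (Y * Y * q − a * (q * q * q) * X) * (a * q − c * (Y * X))
           * (q − b * c * (X * X * X)) * (a * (q * q * q) − b) * (Y − c)
           * (q * q * q * (Y * Y))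
  P₄ X Y = (b * c − q) * (Y * (Y * Y)) * (q − b * (Y * X)) * (Y − c * (X * X))
           * (Y − c * (X * X * q)) * (a * (q * q * q) − b) * (Y − c)
           * (a * (q * q * q * q * q) * (Y * Y))

  P₁−P₂−P₃+P₄≈0 : ∀ X Y → P₁ X Y − P₂ X Y − P₃ X Y + P₄ X Y ≈ 0#
  P₁−P₂−P₃+P₄≈0 X Y = solve 6 (λ a b c q X Y →
      X :* (b :- a :* (q :* q :* q)) :* (a :* q :- c :* (Y :* X)) :* (q :- b :* c) :* (c :- Y)
        :* (a :* (q :* q :* q) :- b :* (Y :* Y :* Y)) :* (Y :- c :* (X :* X))
        :* (q :* q :* q :* q :* (Y :* Y :* Y :* Y))
      :- X :* (:- (Y :* Y)) :* (:- (Y :* Y :* q)) :* (Y :* Y :* q :- a :* (q :* q :* q) :* X)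
        :* (Y :* Y :* q :* q :- a :* (q :* q :* q) :* X) :* (q :- b :* (Y :* X)) :* (b :- a :* (q :* q :* q))
        :* (q :- b :* c) :* (Y :- c)
        :* c
      :- (b :* c :- q) :* (Y :* (Y :* Y)) :* (Y :* Y :* q :- a :* (q :* q :* q) :* X) :* (a :* q :- c :* (Y :* X))
        :* (q :- b :* c :* (X :* X :* X)) :* (a :* (q :* q :* q) :- b) :* (Y :- c)
        :* (q :* q :* q :* (Y :* Y))
      :+ (b :* c :- q) :* (Y :* (Y :* Y)) :* (q :- b :* (Y :* X)) :* (Y :- c :* (X :* X))
        :* (Y :- c :* (X :* X :* q)) :* (a :* (q :* q :* q) :- b) :* (Y :- c)
        :* (a :* (q :* q :* q :* q :* q) :* (Y :* Y))
      := con (ℤ.+ 0)) refl a b c q X Y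

  bcq⁻¹*q³≈bcq² : b * c / q * q ^ 3 ≈ b * c * q ^ 2
  bcq⁻¹*q³≈bcq² = begin
    b * c * q ⁻¹ * (q ^ 2 * q)   ≈⟨ solve 4 (λ x i w q → x :* i :* (w :* q) := x :* w :* (q :* i))
                                            refl (b * c) (q ⁻¹) (q ^ 2) q ⟩
    b * c * q ^ 2 * (q * q ⁻¹)   ≈⟨ x*[y*y⁻¹]≈x q≉0 _ ⟩
    b * c * q ^ 2                ∎

  b/[aq³]*q³≈b/a : b / (a * q ^ 3) * q ^ 3 ≈ b / a
  b/[aq³]*q³≈b/a = x/[y*z]*z≈x/y a≉0 (q^≉0 3) b

  1−c/q^j≉0 : ∀ {j} → NonZero (1# − 1# / c * q ^ j) → NonZero (1# − c / q ^ j)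
  1−c/q^j≉0 {j} φ≉0 = nonZero-cong negated (nonZero-* (nonZero-negate (nonZero-* c≉0 (nonZero-⁻¹ Y≉0))) φ≉0)
    where
    Y = q ^ j
    Y≉0 = q^≉0 j
    negated : - (c / Y) * (1# − 1# / c * Y) ≈ 1# − c / Y
    negated = begin
      - (c / Y) * (1# − 1# / c * Y)
        ≈⟨ *-congˡ (1−-cong (*-congʳ (*-identityˡ _))) ⟩
      - (c / Y) * (1# − c ⁻¹ * Y)
        ≈⟨ solve 5 (λ c yi o ci y → :- (c :* yi) :* (o :- ci :* y) := (c :* ci) :* (y :* yi) :- c :* yi :* o)
                   refl c (Y ⁻¹) 1# (c ⁻¹) Y ⟩
      (c * c ⁻¹) * (Y * Y ⁻¹) − c / Y * 1#
        ≈⟨ +-cong (trans (x*[y*y⁻¹]≈x Y≉0 _) (⁻¹-inverseʳ c≉0)) (-‿cong (*-identityʳ _)) ⟩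
      1# − c / Y ∎

  module LocalIdentity (k j : ℕ) (A≉0 : NonZero (poch (a * q ^ 3) q k))
                       (D≉0 : NonZero (commonDenominator k j)) where
    X = q ^ k
    Y = q ^ j
    D = commonDenominator k j
    M = reversalFactor (a * q ^ 2) (2 *ℕ j)
    I = pochRatio (a * q ^ 3) k (2 *ℕ j)
    Pb = poch (b / q) q (j ℕ.+ k)
    Pc = poch (c / Y) q (2 *ℕ k)
    Ca = poch (c / (a * q)) q (j ℕ.+ k)
    Cb = poch (b * c * q ^ 2) (q ^ 3) k
    Cc = poch (1# / c) q j
    Cd = poch (b / (a * q ^ 3)) (q ^ 3) j
    Ce = poch (b / a) (q ^ 3) j
    Cf = poch (b * c / q) (q ^ 3) k
    φa   = 1# − a * q ^ 3 / b
    φbc  = 1# − b * c / q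
    φqbc = 1# − q / (b * c)
    φY   = 1# − c / Y
    φCa  = 1# − c / (a * q) * q ^ (j ℕ.+ k)
    φCc  = 1# − 1# / c * q ^ j
    φCd  = 1# − b / (a * q ^ 3) * (q ^ 3) ^ j
    φCd₀ = 1# − b / (a * q ^ 3)
    φCf  = 1# − b * c / q * (q ^ 3) ^ k
    φPb  = 1# − b / q * q ^ (j ℕ.+ k)
    φPc  = 1# − c / Y * q ^ (2 *ℕ k)
    φPc′ = 1# − c / Y * q ^ suc (2 *ℕ k)
    φM₁  = - (q ^ (2 *ℕ j) / (a * q ^ 2))
    φM₂  = - (q ^ suc (2 *ℕ j) / (a * q ^ 2))
    φI₁  = 1# − a * q ^ 3 * q ^ k / q ^ suc (2 *ℕ j)
    φI₂  = 1# − a * q ^ 3 * q ^ k / q ^ suc (suc (2 *ℕ j))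
    common = M * I * Pb * Pc
    r₁ = X * φa * φCa * φbc * φCc * φCd * φPc
    r₂ = X * φM₁ * φM₂ * φI₁ * φI₂ * φPb * φa * φbc * φY
    r₃ = φqbc * (Y * q ^ (2 *ℕ j)) * φI₁ * φCa * φCf * φCd₀ * φY
    r₄ = φqbc * (Y * q ^ (2 *ℕ j)) * φPb * φPc * φPc′ * φCd₀ * φY

    D≈₁₂ : D ≈ φa * (Ca * φCa) * (φbc * Cb) * (Cc * φCc) * (Cd * φCd) * φY
    D≈₁₂ = *-congʳ (*-congʳ (*-congʳ (*-congˡ
             (trans (poch-sucˡ _ _ k) (*-congˡ (poch-cong (q ^ 3) k bcq⁻¹*q³≈bcq²))))))

    D≈₃₄ : D ≈ φa * (Ca * φCa) * (Cf * φCf) * (Cc * φCc) * (φCd₀ * Ce) * φY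
    D≈₃₄ = *-congʳ (*-congˡ (trans (poch-sucˡ _ _ j) (*-congˡ (poch-cong (q ^ 3) j b/[aq³]*q³≈b/a))))

    D≈₁ : D ≈ (Ca * Cb * Cc * Cd) * (φa * φCa * φbc * φCc * φCd * φY)
    D≈₁ = trans D≈₁₂ (solve 10 (λ fa ca fca fc cb cc fcc cd fcd fg →
      fa :* (ca :* fca) :* (fc :* cb) :* (cc :* fcc) :* (cd :* fcd) :* fg
        := (ca :* cb :* cc :* cd) :* (fa :* fca :* fc :* fcc :* fcd :* fg))
      refl φa Ca φCa φbc Cb Cc φCc Cd φCd φY)

    D≈₂ : D ≈ ((Ca * φCa) * Cb * (Cc * φCc) * (Cd * φCd)) * (φa * φbc * φY)
    D≈₂ = trans D≈₁₂ (solve 10 (λ fa ca fca fc cb cc fcc cd fcd fg →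
      fa :* (ca :* fca) :* (fc :* cb) :* (cc :* fcc) :* (cd :* fcd) :* fg
        := ((ca :* fca) :* cb :* (cc :* fcc) :* (cd :* fcd)) :* (fa :* fc :* fg))
      refl φa Ca φCa φbc Cb Cc φCc Cd φCd φY)

    D≈₃ : D ≈ (φa * Ca * Ce * Cf * (Cc * φCc)) * (φCa * φCf * φCd₀ * φY)
    D≈₃ = trans D≈₃₄ (solve 10 (λ fa ca fca cf fcf cc fcc fo ce fg →
      fa :* (ca :* fca) :* (cf :* fcf) :* (cc :* fcc) :* (fo :* ce) :* fg
        := (fa :* ca :* ce :* cf :* (cc :* fcc)) :* (fca :* fcf :* fo :* fg))
      refl φa Ca φCa Cf φCf Cc φCc φCd₀ Ce φY)

    D≈₄ : D ≈ (φa * (Ca * φCa) * Ce * (Cf * φCf) * (Cc * φCc)) * (φCd₀ * φY)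
    D≈₄ = trans D≈₃₄ (solve 10 (λ fa ca fca cf fcf cc fcc fo ce fg →
      fa :* (ca :* fca) :* (cf :* fcf) :* (cc :* fcc) :* (fo :* ce) :* fg
        := (fa :* (ca :* fca) :* ce :* (cf :* fcf) :* (cc :* fcc)) :* (fo :* fg))
      refl φa Ca φCa Cf φCf Cc φCc φCd₀ Ce φY)

    M[1+j]≈M*φM₁*φM₂ : reversalFactor (a * q ^ 2) (2 *ℕ suc j) ≈ M * φM₁ * φM₂
    M[1+j]≈M*φM₁*φM₂ = reflexive (P.cong (reversalFactor (a * q ^ 2)) (ℕ.*-suc 2 j))

    I[1+j]≈I*φI₁*φI₂ : pochRatio (a * q ^ 3) k (2 *ℕ suc j) ≈ I * φI₁ * φI₂
    I[1+j]≈I*φI₁*φI₂ = begin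
      pochRatio (a * q ^ 3) k (2 *ℕ suc j)
        ≡⟨ P.cong (pochRatio (a * q ^ 3) k) (ℕ.*-suc 2 j) ⟩
      pochRatio (a * q ^ 3) k (suc (suc (2 *ℕ j)))
        ≈⟨ pochRatio-suc (a * q ^ 3) k (suc (2 *ℕ j)) A≉0 ⟩
      pochRatio (a * q ^ 3) k (suc (2 *ℕ j)) * φI₂
        ≈⟨ *-congʳ (pochRatio-suc (a * q ^ 3) k (2 *ℕ j) A≉0) ⟩
      I * φI₁ * φI₂ ∎

    reversalFactor[aq]≈M*q^2j : reversalFactor (a * q) (2 *ℕ j) ≈ M * q ^ (2 *ℕ j)
    reversalFactor[aq]≈M*q^2j =
      trans (reversalFactor-scale (nonZero-* a≉0 q≉0) q≉0 (2 *ℕ j))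
            (*-congʳ (reversalFactor-cong (nonZero-* (nonZero-* a≉0 q≉0) q≉0)
                                          (trans (*-assoc a q q) (*-congˡ (sym (x^2≈x*x q)))) (2 *ℕ j)))

    f[k,j]*D≈common*r₁ : f k j * D ≈ common * r₁
    f[k,j]*D≈common*r₁ = begin
      f k j * D
        ≈⟨ [x/y]*w≈x*z (nonZeroˡ (nonZero-cong D≈₁ D≉0)) D≈₁ ⟩
      (X * M * I * Pb * poch (c / Y * q) q (2 *ℕ k)) * (φa * φCa * φbc * φCc * φCd * φY)
        ≈⟨ solve 11 (λ x m i pb p fa fca fc fcc fcd fg →
             (x :* m :* i :* pb :* p) :* (fa :* fca :* fc :* fcc :* fcd :* fg)
               := (m :* i :* pb) :* (p :* fg) :* (x :* fa :* fca :* fc :* fcc :* fcd))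
             refl X M I Pb (poch (c / Y * q) q (2 *ℕ k)) φa φCa φbc φCc φCd φY ⟩
      (M * I * Pb) * (poch (c / Y * q) q (2 *ℕ k) * φY) * (X * φa * φCa * φbc * φCc * φCd)
        ≈⟨ *-congʳ (*-congˡ (poch-shift (c / Y) q (2 *ℕ k))) ⟩
      (M * I * Pb) * (Pc * φPc) * (X * φa * φCa * φbc * φCc * φCd)
        ≈⟨ solve 11 (λ m i pb pc f1 x fa fca fc fcc fcd →
             (m :* i :* pb) :* (pc :* f1) :* (x :* fa :* fca :* fc :* fcc :* fcd)
               := (m :* i :* pb :* pc) :* (x :* fa :* fca :* fc :* fcc :* fcd :* f1))
             refl M I Pb Pc φPc X φa φCa φbc φCc φCd ⟩
      common * r₁ ∎

    f[k,1+j]*D≈common*r₂ : f k (suc j) * D ≈ common * r₂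
    f[k,1+j]*D≈common*r₂ = begin
      f k (suc j) * D
        ≈⟨ [x/y]*w≈x*z (nonZeroˡ (nonZero-cong D≈₂ D≉0)) D≈₂ ⟩
      (X * reversalFactor (a * q ^ 2) (2 *ℕ suc j) * pochRatio (a * q ^ 3) k (2 *ℕ suc j)
         * (Pb * φPb) * poch (c / q ^ suc j * q) q (2 *ℕ k)) * (φa * φbc * φY)
        ≈⟨ *-congʳ (*-cong (*-cong (*-cong (*-congˡ M[1+j]≈M*φM₁*φM₂) I[1+j]≈I*φI₁*φI₂) refl)
                           (poch-cong q (2 *ℕ k) (x/[y*z]*z≈x/y (q^≉0 j) q≉0 c))) ⟩
      (X * (M * φM₁ * φM₂) * (I * φI₁ * φI₂) * (Pb * φPb) * Pc) * (φa * φbc * φY)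
        ≈⟨ solve 13 (λ x m fh fi i fj fk pb fl pc fa fc fg →
             (x :* (m :* fh :* fi) :* (i :* fj :* fk) :* (pb :* fl) :* pc) :* (fa :* fc :* fg)
               := (m :* i :* pb :* pc) :* (x :* fh :* fi :* fj :* fk :* fl :* fa :* fc :* fg))
             refl X M φM₁ φM₂ I φI₁ φI₂ Pb φPb Pc φa φbc φY ⟩
      common * r₂ ∎

    g[k,j]*D≈common*r₃ : g k j * D ≈ common * r₃
    g[k,j]*D≈common*r₃ = begin
      g k j * D
        ≈⟨ [x/y]*w≈x*z (nonZeroˡ (nonZero-cong D≈₃ D≉0)) D≈₃ ⟩
      (φqbc * Y * reversalFactor (a * q) (2 *ℕ j) * pochRatio (a * q ^ 3) k (suc (2 *ℕ j)) * Pb * Pc)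
        * (φCa * φCf * φCd₀ * φY)
        ≈⟨ *-congʳ (*-congʳ (*-congʳ (*-cong (*-congˡ reversalFactor[aq]≈M*q^2j)
                                             (pochRatio-suc (a * q ^ 3) k (2 *ℕ j) A≉0)))) ⟩
      (φqbc * Y * (M * q ^ (2 *ℕ j)) * (I * φI₁) * Pb * Pc) * (φCa * φCf * φCd₀ * φY)
        ≈⟨ solve 12 (λ fm y m q2 i fj pb pc fca fcf fo fg →
             (fm :* y :* (m :* q2) :* (i :* fj) :* pb :* pc) :* (fca :* fcf :* fo :* fg)
               := (m :* i :* pb :* pc) :* (fm :* (y :* q2) :* fj :* fca :* fcf :* fo :* fg))
             refl φqbc Y M (q ^ (2 *ℕ j)) I φI₁ Pb Pc φCa φCf φCd₀ φY ⟩
      common * r₃ ∎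

    g[1+k,j]*D≈common*r₄ : g (suc k) j * D ≈ common * r₄
    g[1+k,j]*D≈common*r₄ = begin
      g (suc k) j * D
        ≡⟨ P.cong (_* D) (P.cong₂ (g-with (suc k) j) (ℕ.+-suc j k) (ℕ.*-suc 2 k)) ⟩
      g-with (suc k) j (suc (j ℕ.+ k)) (suc (suc (2 *ℕ k))) * D
        ≈⟨ [x/y]*w≈x*z (nonZeroˡ (nonZero-cong D≈₄ D≉0)) D≈₄ ⟩
      (φqbc * Y * reversalFactor (a * q) (2 *ℕ j) * I * (Pb * φPb) * (Pc * φPc * φPc′)) * (φCd₀ * φY)
        ≈⟨ *-congʳ (*-congʳ (*-congʳ (*-congʳ (*-congˡ reversalFactor[aq]≈M*q^2j)))) ⟩
      (φqbc * Y * (M * q ^ (2 *ℕ j)) * I * (Pb * φPb) * (Pc * φPc * φPc′)) * (φCd₀ * φY)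
        ≈⟨ solve 12 (λ fm y m q2 i pb fl pc f1 f4 fo fg →
             (fm :* y :* (m :* q2) :* i :* (pb :* fl) :* (pc :* f1 :* f4)) :* (fo :* fg)
               := (m :* i :* pb :* pc) :* (fm :* (y :* q2) :* fl :* f1 :* f4 :* fo :* fg))
             refl φqbc Y M (q ^ (2 *ℕ j)) I Pb φPb Pc φPc φPc′ φCd₀ φY ⟩
      common * r₄ ∎

    Q2 = q * q
    Q3 = q * q * q
    Y≉0 = q^≉0 j
    aq≉0 = nonZero-* a≉0 q≉0
    aQ2≉0 = nonZero-* a≉0 (nonZero-* q≉0 q≉0)
    aQ3≉0 = nonZero-* a≉0 (nonZero-* (nonZero-* q≉0 q≉0) q≉0)
    YYq≉0 = nonZero-* (nonZero-* Y≉0 Y≉0) q≉0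
    YYqq≉0 = nonZero-* YYq≉0 q≉0
    bc≉0 = nonZero-* b≉0 c≉0

    q^[j+k]≈Y*X : q ^ (j ℕ.+ k) ≈ Y * X
    q^[j+k]≈Y*X = ^-distribˡ-+-* q j k

    aq³≈aQ3 : a * q ^ 3 ≈ a * Q3
    aq³≈aQ3 = *-congˡ (x^3≈x*x*x q)

    [aq³]⁻¹≈[aQ3]⁻¹ : (a * q ^ 3) ⁻¹ ≈ (a * Q3) ⁻¹
    [aq³]⁻¹≈[aQ3]⁻¹ = ⁻¹-cong (nonZero-* a≉0 (q^≉0 3)) aq³≈aQ3

    [aq²]⁻¹≈[aQ2]⁻¹ : (a * q ^ 2) ⁻¹ ≈ (a * Q2) ⁻¹
    [aq²]⁻¹≈[aQ2]⁻¹ = ⁻¹-cong (nonZero-* a≉0 (q^≉0 2)) (*-congˡ (x^2≈x*x q))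

    x*y*z≈x*z*y : ∀ x y z → x * y * z ≈ x * z * y
    x*y*z≈x*z*y = solve 3 (λ x y z → x :* y :* z := x :* z :* y) refl

    φa≈ : φa ≈ (b − a * Q3) / b
    φa≈ = trans (1−-cong (*-congʳ aq³≈aQ3)) (1−x/y≈[y−x]/y b≉0 (a * Q3))

    φbc≈ : φbc ≈ (q − b * c) / q
    φbc≈ = 1−x/y≈[y−x]/y q≉0 (b * c)

    φqbc≈ : φqbc ≈ (b * c − q) / (b * c)
    φqbc≈ = 1−x/y≈[y−x]/y bc≉0 q

    φY≈ : φY ≈ (Y − c) / Y
    φY≈ = 1−x/y≈[y−x]/y Y≉0 c

    φCa≈ : φCa ≈ (a * q − c * (Y * X)) / (a * q)
    φCa≈ = trans (1−-cong (trans (*-congˡ q^[j+k]≈Y*X) (x*y*z≈x*z*y c _ _))) (1−x/y≈[y−x]/y aq≉0 _)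

    φCc≈ : φCc ≈ (c − Y) / c
    φCc≈ = trans (1−-cong (trans (*-congʳ (*-identityˡ _)) (*-comm _ _))) (1−x/y≈[y−x]/y c≉0 Y)

    φCd≈ : φCd ≈ (a * Q3 − b * (Y * Y * Y)) / (a * Q3)
    φCd≈ = trans (1−-cong (trans (*-cong (*-congˡ [aq³]⁻¹≈[aQ3]⁻¹) ([x^3]^n≈x^n*x^n*x^n q j))
                                 (x*y*z≈x*z*y b _ _)))
                 (1−x/y≈[y−x]/y aQ3≉0 _)

    φCd₀≈ : φCd₀ ≈ (a * Q3 − b) / (a * Q3)
    φCd₀≈ = trans (1−-cong (*-congˡ [aq³]⁻¹≈[aQ3]⁻¹)) (1−x/y≈[y−x]/y aQ3≉0 b)

    φCf≈ : φCf ≈ (q − b * c * (X * X * X)) / q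
    φCf≈ = trans (1−-cong (trans (*-congˡ ([x^3]^n≈x^n*x^n*x^n q k)) (x*y*z≈x*z*y (b * c) _ _)))
                 (1−x/y≈[y−x]/y q≉0 _)

    φPb≈ : φPb ≈ (q − b * (Y * X)) / q
    φPb≈ = trans (1−-cong (trans (*-congˡ q^[j+k]≈Y*X) (x*y*z≈x*z*y b _ _))) (1−x/y≈[y−x]/y q≉0 _)

    φPc≈ : φPc ≈ (Y − c * (X * X)) / Y
    φPc≈ = trans (1−-cong (trans (*-congˡ (x^[2*n]≈x^n*x^n q k)) (x*y*z≈x*z*y c _ _)))
                 (1−x/y≈[y−x]/y Y≉0 _)

    φPc′≈ : φPc′ ≈ (Y − c * (X * X * q)) / Y
    φPc′≈ = trans (1−-cong (trans (*-congˡ (*-congʳ (x^[2*n]≈x^n*x^n q k))) (x*y*z≈x*z*y c _ _)))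
                  (1−x/y≈[y−x]/y Y≉0 _)

    φM₁≈ : φM₁ ≈ (- (Y * Y)) / (a * Q2)
    φM₁≈ = trans (-‿cong (*-cong (x^[2*n]≈x^n*x^n q j) [aq²]⁻¹≈[aQ2]⁻¹)) (-‿distribˡ-* _ _)

    φM₂≈ : φM₂ ≈ (- (Y * Y * q)) / (a * Q2)
    φM₂≈ = trans (-‿cong (*-cong (*-congʳ (x^[2*n]≈x^n*x^n q j)) [aq²]⁻¹≈[aQ2]⁻¹)) (-‿distribˡ-* _ _)

    φI₁≈ : φI₁ ≈ (Y * Y * q − a * Q3 * X) / (Y * Y * q)
    φI₁≈ = trans (1−-cong (*-cong (*-congʳ aq³≈aQ3)
                                  (⁻¹-cong (q^≉0 (suc (2 *ℕ j))) (*-congʳ (x^[2*n]≈x^n*x^n q j)))))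
                 (1−x/y≈[y−x]/y YYq≉0 _)

    φI₂≈ : φI₂ ≈ (Y * Y * q * q − a * Q3 * X) / (Y * Y * q * q)
    φI₂≈ = trans (1−-cong (*-cong (*-congʳ aq³≈aQ3)
                                  (⁻¹-cong (q^≉0 (suc (suc (2 *ℕ j))))
                                           (*-congʳ (*-congʳ (x^[2*n]≈x^n*x^n q j))))))
                 (1−x/y≈[y−x]/y YYqq≉0 _)

    Y*q^2j≈Y*[Y*Y] : Y * q ^ (2 *ℕ j) ≈ Y * (Y * Y)
    Y*q^2j≈Y*[Y*Y] = *-congˡ (x^[2*n]≈x^n*x^n q j)

    clearing = a * a * b * c * (q * q * q * q * q * q * q * q * q) * (Y * Y * Y * Y * Y)

    clearing≉0 : NonZero clearing
    clearing≉0 = nonZero-* (nonZero-* (nonZero-* (nonZero-* (nonZero-* a≉0 a≉0) b≉0) c≉0) q⁹≉0) Y⁵≉0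
      where
      q⁹≉0 = nonZero-* (nonZero-* (nonZero-* (nonZero-* (nonZero-* (nonZero-* (nonZero-*
               (nonZero-* q≉0 q≉0) q≉0) q≉0) q≉0) q≉0) q≉0) q≉0) q≉0
      Y⁵≉0 = nonZero-* (nonZero-* (nonZero-* (nonZero-* Y≉0 Y≉0) Y≉0) Y≉0) Y≉0

    -- Each rᵢ is a product of fractions; the solver multiplies it out against the clearing
    -- factor, leaving Pᵢ times a product of terms w * w⁻¹.
    cleared : ∀ {r r′ p u} → r ≈ r′ → clearing * r′ ≈ p * u → u ≈ 1# → clearing * r ≈ p
    cleared r≈r′ eq u≈1 = trans (*-congˡ r≈r′) (trans eq (trans (*-congˡ u≈1) (*-identityʳ _)))

    clearing*r₁≈P₁ : clearing * r₁ ≈ P₁ X Y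
    clearing*r₁≈P₁ = cleared
      (*-cong (*-cong (*-cong (*-cong (*-cong (*-congˡ φa≈) φCa≈) φbc≈) φCc≈) φCd≈) φPc≈)
      (solve 12 (λ a b c q X Y bi aqi qi ci a3i yi →
         (a :* a :* b :* c :* (q :* q :* q :* q :* q :* q :* q :* q :* q) :* (Y :* Y :* Y :* Y :* Y))
         :* (X :* ((b :- a :* (q :* q :* q)) :* bi) :* ((a :* q :- c :* (Y :* X)) :* aqi)
               :* ((q :- b :* c) :* qi) :* ((c :- Y) :* ci)
               :* ((a :* (q :* q :* q) :- b :* (Y :* Y :* Y)) :* a3i) :* ((Y :- c :* (X :* X)) :* yi))
         := (X :* (b :- a :* (q :* q :* q)) :* (a :* q :- c :* (Y :* X)) :* (q :- b :* c) :* (c :- Y)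
               :* (a :* (q :* q :* q) :- b :* (Y :* Y :* Y)) :* (Y :- c :* (X :* X))
               :* (q :* q :* q :* q :* (Y :* Y :* Y :* Y)))
            :* (b :* bi :* ((a :* q) :* aqi) :* (q :* qi) :* (c :* ci) :* ((a :* (q :* q :* q)) :* a3i)
               :* (Y :* yi)))
         refl a b c q X Y (b ⁻¹) ((a * q) ⁻¹) (q ⁻¹) (c ⁻¹) ((a * Q3) ⁻¹) (Y ⁻¹))
      (pairs (pairs (pairs (pairs (pairs (⁻¹-inverseʳ b≉0) aq≉0) q≉0) c≉0) aQ3≉0) Y≉0)
      where pairs = x≈1⇒x*[y*y⁻¹]≈1

    clearing*r₂≈P₂ : clearing * r₂ ≈ P₂ X Y
    clearing*r₂≈P₂ = cleared
      (*-cong (*-cong (*-cong (*-cong (*-cong (*-cong (*-cong (*-congˡ φM₁≈) φM₂≈) φI₁≈) φI₂≈) φPb≈)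
                      φa≈) φbc≈) φY≈)
      (solve 12 (λ a b c q X Y a2i y2qi y2q2i qi bi yi →
         (a :* a :* b :* c :* (q :* q :* q :* q :* q :* q :* q :* q :* q) :* (Y :* Y :* Y :* Y :* Y))
         :* (X :* ((:- (Y :* Y)) :* a2i) :* ((:- (Y :* Y :* q)) :* a2i)
               :* ((Y :* Y :* q :- a :* (q :* q :* q) :* X) :* y2qi)
               :* ((Y :* Y :* q :* q :- a :* (q :* q :* q) :* X) :* y2q2i)
               :* ((q :- b :* (Y :* X)) :* qi) :* ((b :- a :* (q :* q :* q)) :* bi)
               :* ((q :- b :* c) :* qi) :* ((Y :- c) :* yi))
         := (X :* (:- (Y :* Y)) :* (:- (Y :* Y :* q)) :* (Y :* Y :* q :- a :* (q :* q :* q) :* X)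
               :* (Y :* Y :* q :* q :- a :* (q :* q :* q) :* X) :* (q :- b :* (Y :* X))
               :* (b :- a :* (q :* q :* q)) :* (q :- b :* c) :* (Y :- c)
               :* c)
            :* ((a :* (q :* q)) :* a2i :* ((a :* (q :* q)) :* a2i) :* ((Y :* Y :* q) :* y2qi)
               :* ((Y :* Y :* q :* q) :* y2q2i) :* (q :* qi) :* (b :* bi) :* (q :* qi) :* (Y :* yi)))
         refl a b c q X Y ((a * Q2) ⁻¹) ((Y * Y * q) ⁻¹) ((Y * Y * q * q) ⁻¹) (q ⁻¹) (b ⁻¹) (Y ⁻¹))
      (pairs (pairs (pairs (pairs (pairs (pairs (pairs (⁻¹-inverseʳ aQ2≉0) aQ2≉0) YYq≉0) YYqq≉0)
                                  q≉0) b≉0) q≉0) Y≉0)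
      where pairs = x≈1⇒x*[y*y⁻¹]≈1

    clearing*r₃≈P₃ : clearing * r₃ ≈ P₃ X Y
    clearing*r₃≈P₃ = cleared
      (*-cong (*-cong (*-cong (*-cong (*-cong (*-cong φqbc≈ Y*q^2j≈Y*[Y*Y]) φI₁≈) φCa≈) φCf≈) φCd₀≈) φY≈)
      (solve 12 (λ a b c q X Y bci y2qi aqi qi a3i yi →
         (a :* a :* b :* c :* (q :* q :* q :* q :* q :* q :* q :* q :* q) :* (Y :* Y :* Y :* Y :* Y))
         :* (((b :* c :- q) :* bci) :* (Y :* (Y :* Y)) :* ((Y :* Y :* q :- a :* (q :* q :* q) :* X) :* y2qi)
               :* ((a :* q :- c :* (Y :* X)) :* aqi) :* ((q :- b :* c :* (X :* X :* X)) :* qi)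
               :* ((a :* (q :* q :* q) :- b) :* a3i) :* ((Y :- c) :* yi))
         := ((b :* c :- q) :* (Y :* (Y :* Y)) :* (Y :* Y :* q :- a :* (q :* q :* q) :* X)
               :* (a :* q :- c :* (Y :* X)) :* (q :- b :* c :* (X :* X :* X)) :* (a :* (q :* q :* q) :- b)
               :* (Y :- c)
               :* (q :* q :* q :* (Y :* Y)))
            :* ((b :* c) :* bci :* ((Y :* Y :* q) :* y2qi) :* ((a :* q) :* aqi) :* (q :* qi)
               :* ((a :* (q :* q :* q)) :* a3i) :* (Y :* yi)))
         refl a b c q X Y ((b * c) ⁻¹) ((Y * Y * q) ⁻¹) ((a * q) ⁻¹) (q ⁻¹) ((a * Q3) ⁻¹) (Y ⁻¹))
      (pairs (pairs (pairs (pairs (pairs (⁻¹-inverseʳ bc≉0) YYq≉0) aq≉0) q≉0) aQ3≉0) Y≉0)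
      where pairs = x≈1⇒x*[y*y⁻¹]≈1

    clearing*r₄≈P₄ : clearing * r₄ ≈ P₄ X Y
    clearing*r₄≈P₄ = cleared
      (*-cong (*-cong (*-cong (*-cong (*-cong (*-cong φqbc≈ Y*q^2j≈Y*[Y*Y]) φPb≈) φPc≈) φPc′≈) φCd₀≈) φY≈)
      (solve 10 (λ a b c q X Y bci qi yi a3i →
         (a :* a :* b :* c :* (q :* q :* q :* q :* q :* q :* q :* q :* q) :* (Y :* Y :* Y :* Y :* Y))
         :* (((b :* c :- q) :* bci) :* (Y :* (Y :* Y)) :* ((q :- b :* (Y :* X)) :* qi)
               :* ((Y :- c :* (X :* X)) :* yi) :* ((Y :- c :* (X :* X :* q)) :* yi)
               :* ((a :* (q :* q :* q) :- b) :* a3i) :* ((Y :- c) :* yi))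
         := ((b :* c :- q) :* (Y :* (Y :* Y)) :* (q :- b :* (Y :* X)) :* (Y :- c :* (X :* X))
               :* (Y :- c :* (X :* X :* q)) :* (a :* (q :* q :* q) :- b) :* (Y :- c)
               :* (a :* (q :* q :* q :* q :* q) :* (Y :* Y)))
            :* ((b :* c) :* bci :* (q :* qi) :* (Y :* yi) :* (Y :* yi) :* ((a :* (q :* q :* q)) :* a3i)
               :* (Y :* yi)))
         refl a b c q X Y ((b * c) ⁻¹) (q ⁻¹) (Y ⁻¹) ((a * Q3) ⁻¹))
      (pairs (pairs (pairs (pairs (pairs (⁻¹-inverseʳ bc≉0) q≉0) Y≉0) Y≉0) aQ3≉0) Y≉0)
      where pairs = x≈1⇒x*[y*y⁻¹]≈1

    r₁−r₂−r₃+r₄≈0 : r₁ − r₂ − r₃ + r₄ ≈ 0#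
    r₁−r₂−r₃+r₄≈0 = x*y≈0⇒y≈0 clearing≉0 (begin
      clearing * (r₁ − r₂ − r₃ + r₄)
        ≈⟨ solve 5 (λ l r₁ r₂ r₃ r₄ → l :* (r₁ :- r₂ :- r₃ :+ r₄)
                                    := l :* r₁ :- l :* r₂ :- l :* r₃ :+ l :* r₄)
                   refl clearing r₁ r₂ r₃ r₄ ⟩
      clearing * r₁ − clearing * r₂ − clearing * r₃ + clearing * r₄
        ≈⟨ +-cong (+-cong (+-cong clearing*r₁≈P₁ (-‿cong clearing*r₂≈P₂)) (-‿cong clearing*r₃≈P₃))
                  clearing*r₄≈P₄ ⟩
      P₁ X Y − P₂ X Y − P₃ X Y + P₄ X Y
        ≈⟨ P₁−P₂−P₃+P₄≈0 X Y ⟩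
      0# ∎)

    local-identity : f k j − f k (suc j) ≈ g k j − g (suc k) j
    local-identity = begin
      f₁ − f₂
        ≈⟨ solve 4 (λ a b c d → a :- b := (a :- b :- c :+ d) :+ (c :- d)) refl f₁ f₂ g₁ g₂ ⟩
      (f₁ − f₂ − g₁ + g₂) + (g₁ − g₂)
        ≈⟨ +-congʳ (x*y≈0⇒y≈0 D≉0 D*[f₁−f₂−g₁+g₂]≈0) ⟩
      0# + (g₁ − g₂)
        ≈⟨ +-identityˡ _ ⟩
      g₁ − g₂ ∎
      where
      f₁ = f k j
      f₂ = f k (suc j)
      g₁ = g k j
      g₂ = g (suc k) j
      D*[f₁−f₂−g₁+g₂]≈0 : D * (f₁ − f₂ − g₁ + g₂) ≈ 0#
      D*[f₁−f₂−g₁+g₂]≈0 = begin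
        D * (f₁ − f₂ − g₁ + g₂)
          ≈⟨ solve 5 (λ d a b c e → d :* (a :- b :- c :+ e) := a :* d :- b :* d :- c :* d :+ e :* d)
                     refl D f₁ f₂ g₁ g₂ ⟩
        f₁ * D − f₂ * D − g₁ * D + g₂ * D
          ≈⟨ +-cong (+-cong (+-cong f[k,j]*D≈common*r₁ (-‿cong f[k,1+j]*D≈common*r₂))
                            (-‿cong g[k,j]*D≈common*r₃)) g[1+k,j]*D≈common*r₄ ⟩
        common * r₁ − common * r₂ − common * r₃ + common * r₄
          ≈⟨ solve 5 (λ n a b c d → n :* a :- n :* b :- n :* c :+ n :* d := n :* (a :- b :- c :+ d))
                     refl common r₁ r₂ r₃ r₄ ⟩
        common * (r₁ − r₂ − r₃ + r₄)
          ≈⟨ *-congˡ r₁−r₂−r₃+r₄≈0 ⟩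
        common * 0#
          ≈⟨ zeroʳ common ⟩
        0# ∎

  Ω-term≈f[k,0] : ∀ k → NonZero (ΩDen a b c q k) → q ^ k * ΩNum a b c q k / ΩDen a b c q k ≈ f k 0
  Ω-term≈f[k,0] k Den≉0 = begin
    q ^ k * (Nb * Nc) / (A * Ca * Cb)
      ≈⟨ *-congˡ (⁻¹-distrib-*³ A≉0 Ca≉0 Cb≉0) ⟩
    q ^ k * (Nb * Nc) * (A ⁻¹ * Ca ⁻¹ * Cb ⁻¹)
      ≈⟨ solve 6 (λ x nb nc ai cai cbi → x :* (nb :* nc) :* (ai :* cai :* cbi)
                                      := x :* ai :* nb :* nc :* (cai :* cbi))
                 refl (q ^ k) Nb Nc (A ⁻¹) (Ca ⁻¹) (Cb ⁻¹) ⟩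
    q ^ k * A ⁻¹ * Nb * Nc * (Ca ⁻¹ * Cb ⁻¹)
      ≈⟨ *-cong (*-cong (*-congʳ (*-congʳ (sym (*-identityʳ (q ^ k))))) (poch-cong q (2 *ℕ k) cq≈c/q⁰*q))
                (sym (trans (⁻¹-cong (nonZero-cong (sym Ca*Cb*1*1≈Ca*Cb) (nonZero-* Ca≉0 Cb≉0))
                                     Ca*Cb*1*1≈Ca*Cb)
                            (⁻¹-distrib-* Ca≉0 Cb≉0))) ⟩
    q ^ k * 1# * A ⁻¹ * Nb * poch (c / q ^ 0 * q) q (2 *ℕ k) / (Ca * Cb * 1# * 1#) ∎
    where
    A  = poch (a * q ^ 3) q k
    Ca = poch (c / (a * q)) q k
    Cb = poch (b * c * q ^ 2) (q ^ 3) k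
    Nb = poch (b / q) q k
    Nc = poch (c * q) q (2 *ℕ k)
    A≉0  = nonZeroˡ (nonZeroˡ Den≉0)
    Ca≉0 = nonZeroʳ (nonZeroˡ Den≉0)
    Cb≉0 = nonZeroʳ Den≉0
    Ca*Cb*1*1≈Ca*Cb : Ca * Cb * 1# * 1# ≈ Ca * Cb
    Ca*Cb*1*1≈Ca*Cb = trans (*-identityʳ _) (*-identityʳ _)
    cq≈c/q⁰*q : c * q ≈ c / q ^ 0 * q
    cq≈c/q⁰*q = *-congʳ (sym (trans (*-congˡ 1⁻¹≈1) (*-identityʳ c)))

  module Shifted (m : ℕ) where
    a′ = a / q ^ (2 *ℕ m)
    b′ = b * q ^ m
    c′ = c / q ^ m

    prefactor = poch (1# / (a * q ^ 2)) q (2 *ℕ m) * poch (b / q) q m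
                / (poch (c / (a * q)) q m * poch (1# / c) q m * poch (b / (a * q ^ 3)) (q ^ 3) m)

    aq²*q/q^2m≈a′q³ : a * q ^ 2 * q / q ^ (2 *ℕ m) ≈ a′ * q ^ 3
    aq²*q/q^2m≈a′q³ = solve 4 (λ a q2 q i → a :* q2 :* q :* i := a :* i :* (q2 :* q))
                              refl a (q ^ 2) q ((q ^ (2 *ℕ m)) ⁻¹)

    a′q³*q^2m≈aq³ : a′ * q ^ 3 * q ^ (2 *ℕ m) ≈ a * q ^ 3
    a′q³*q^2m≈aq³ =
      trans (solve 4 (λ a i q3 w → a :* i :* q3 :* w := a :* q3 :* (w :* i))
                     refl a ((q ^ (2 *ℕ m)) ⁻¹) (q ^ 3) (q ^ (2 *ℕ m)))
            (x*[y*y⁻¹]≈x (q^≉0 (2 *ℕ m)) _)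

    b′/q≈b/q*q^m : b′ / q ≈ b / q * q ^ m
    b′/q≈b/q*q^m = solve 3 (λ b y i → b :* y :* i := b :* i :* y) refl b (q ^ m) (q ⁻¹)

    c/[aq]*q^m≈c′/[a′q] : c / (a * q) * q ^ m ≈ c′ / (a′ * q)
    c/[aq]*q^m≈c′/[a′q] = sym (begin
      c * M ⁻¹ * (a * (q ^ (2 *ℕ m)) ⁻¹ * q) ⁻¹
        ≈⟨ *-congˡ (⁻¹-distrib-*³ a≉0 (nonZero-⁻¹ (q^≉0 (2 *ℕ m))) q≉0) ⟩
      c * M ⁻¹ * (a ⁻¹ * ((q ^ (2 *ℕ m)) ⁻¹) ⁻¹ * q ⁻¹)
        ≈⟨ *-congˡ (*-congʳ (*-congˡ (trans (⁻¹-involutive (q^≉0 (2 *ℕ m))) (x^[2*n]≈x^n*x^n q m)))) ⟩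
      c * M ⁻¹ * (a ⁻¹ * (M * M) * q ⁻¹)
        ≈⟨ solve 5 (λ c mi ai m qi → c :* mi :* (ai :* (m :* m) :* qi)
                                   := c :* (ai :* qi) :* m :* (m :* mi))
                   refl c (M ⁻¹) (a ⁻¹) M (q ⁻¹) ⟩
      c * (a ⁻¹ * q ⁻¹) * M * (M * M ⁻¹)
        ≈⟨ x*[y*y⁻¹]≈x (q^≉0 m) _ ⟩
      c * (a ⁻¹ * q ⁻¹) * M
        ≈⟨ *-congʳ (*-congˡ (sym (⁻¹-distrib-* a≉0 q≉0))) ⟩
      c / (a * q) * M ∎)
      where M = q ^ m

    b′c′q²≈bcq² : b′ * c′ * q ^ 2 ≈ b * c * q ^ 2
    b′c′q²≈bcq² =
      trans (solve 5 (λ b m c i q2 → b :* m :* (c :* i) :* q2 := b :* c :* q2 :* (m :* i))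
                     refl b (q ^ m) c ((q ^ m) ⁻¹) (q ^ 2))
            (x*[y*y⁻¹]≈x (q^≉0 m) _)

    [1/[aq²]]₂ₘ/[a′q³]ₖ≈ : ∀ k → NonZero (poch (a′ * q ^ 3) q k) →
      poch (1# / (a * q ^ 2)) q (2 *ℕ m) / poch (a′ * q ^ 3) q k
      ≈ reversalFactor (a * q ^ 2) (2 *ℕ m) * pochRatio (a * q ^ 3) k (2 *ℕ m)
    [1/[aq²]]₂ₘ/[a′q³]ₖ≈ k A′≉0 = begin
      poch (1# / (a * q ^ 2)) q (2 *ℕ m) / A′
        ≈⟨ *-congʳ (poch-reverse (nonZero-* a≉0 (q^≉0 2)) (2 *ℕ m)) ⟩
      R * poch (a * q ^ 2 * q / q ^ (2 *ℕ m)) q (2 *ℕ m) / A′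
        ≈⟨ *-assoc _ _ _ ⟩
      R * (poch (a * q ^ 2 * q / q ^ (2 *ℕ m)) q (2 *ℕ m) / A′)
        ≈⟨ *-congˡ (*-congʳ (poch-cong q (2 *ℕ m) aq²*q/q^2m≈a′q³)) ⟩
      R * (poch (a′ * q ^ 3) q (2 *ℕ m) / A′)
        ≈⟨ *-congˡ (poch/poch≈pochRatio (a * q ^ 3) k (2 *ℕ m) (a′ * q ^ 3) a′q³*q^2m≈aq³ A′≉0) ⟩
      R * pochRatio (a * q ^ 3) k (2 *ℕ m) ∎
      where
      R  = reversalFactor (a * q ^ 2) (2 *ℕ m)
      A′ = poch (a′ * q ^ 3) q k

    [b/q]ₘ[b′/q]ₖ≈[b/q]ₘ₊ₖ : ∀ k → poch (b / q) q m * poch (b′ / q) q k ≈ poch (b / q) q (m ℕ.+ k)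
    [b/q]ₘ[b′/q]ₖ≈[b/q]ₘ₊ₖ k = sym (trans (poch-+ (b / q) q m k) (*-congˡ (poch-cong q k (sym b′/q≈b/q*q^m))))

    [c/[aq]]ₘ₊ₖ≈[c/[aq]]ₘ[c′/[a′q]]ₖ : ∀ k →
      poch (c / (a * q)) q (m ℕ.+ k) ≈ poch (c / (a * q)) q m * poch (c′ / (a′ * q)) q k
    [c/[aq]]ₘ₊ₖ≈[c/[aq]]ₘ[c′/[a′q]]ₖ k =
      trans (poch-+ (c / (a * q)) q m k) (*-congˡ (poch-cong q k c/[aq]*q^m≈c′/[a′q]))

    Ω′-term*prefactor≈f[k,m] :
      ∀ k → NonZero (ΩDen a′ b′ c′ q k) →
      NonZero (poch (c / (a * q)) q m * poch (1# / c) q m * poch (b / (a * q ^ 3)) (q ^ 3) m) →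
      q ^ k * ΩNum a′ b′ c′ q k / ΩDen a′ b′ c′ q k * prefactor ≈ f k m
    Ω′-term*prefactor≈f[k,m] k Den≉0 Pre≉0 = begin
      q ^ k * (Nb′ * Nc′) / (A′ * Ca′ * Cb′) * ((P1 * Pbm) / (Cam * Ccm * Cdm))
        ≈⟨ *-cong (*-congˡ (⁻¹-distrib-*³ A′≉0 Ca′≉0 Cb′≉0))
                  (*-congˡ (⁻¹-distrib-*³ Cam≉0 Ccm≉0 Cdm≉0)) ⟩
      q ^ k * (Nb′ * Nc′) * (A′ ⁻¹ * Ca′ ⁻¹ * Cb′ ⁻¹) * ((P1 * Pbm) * (Cam ⁻¹ * Ccm ⁻¹ * Cdm ⁻¹))
        ≈⟨ solve 11 (λ x nb nc ai cai cbi p1 pb cami ccmi cdmi →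
             x :* (nb :* nc) :* (ai :* cai :* cbi) :* ((p1 :* pb) :* (cami :* ccmi :* cdmi))
               := x :* (p1 :* ai) :* (pb :* nb) :* nc :* (cami :* cai) :* cbi :* ccmi :* cdmi)
             refl (q ^ k) Nb′ Nc′ (A′ ⁻¹) (Ca′ ⁻¹) (Cb′ ⁻¹) P1 Pbm (Cam ⁻¹) (Ccm ⁻¹) (Cdm ⁻¹) ⟩
      q ^ k * (P1 / A′) * (Pbm * Nb′) * Nc′ * (Cam ⁻¹ * Ca′ ⁻¹) * Cb′ ⁻¹ * Ccm ⁻¹ * Cdm ⁻¹
        ≈⟨ *-congʳ (*-congʳ (*-cong (*-cong (*-congʳ (*-cong (*-congˡ ([1/[aq²]]₂ₘ/[a′q³]ₖ≈ k A′≉0))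
                                                             ([b/q]ₘ[b′/q]ₖ≈[b/q]ₘ₊ₖ k)))
                                            Cam⁻¹Ca′⁻¹≈Camk⁻¹)
                                    (⁻¹-cong Cb′≉0 (poch-cong (q ^ 3) k b′c′q²≈bcq²)))) ⟩
      q ^ k * (R * I) * Pmk * Nc′ * Camk ⁻¹ * Cb ⁻¹ * Ccm ⁻¹ * Cdm ⁻¹
        ≈⟨ solve 9 (λ x r i pm nc ca cb cc cd → x :* (r :* i) :* pm :* nc :* ca :* cb :* cc :* cd
                                             := x :* r :* i :* pm :* nc :* (ca :* cb :* cc :* cd))
                   refl (q ^ k) R I Pmk Nc′ (Camk ⁻¹) (Cb ⁻¹) (Ccm ⁻¹) (Cdm ⁻¹) ⟩
      q ^ k * R * I * Pmk * Nc′ * (Camk ⁻¹ * Cb ⁻¹ * Ccm ⁻¹ * Cdm ⁻¹)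
        ≈⟨ *-congˡ (sym (⁻¹-distrib-*⁴ Camk≉0 Cb≉0 Ccm≉0 Cdm≉0)) ⟩
      f k m ∎
      where
      Nb′ = poch (b′ / q) q k
      Nc′ = poch (c′ * q) q (2 *ℕ k)
      A′  = poch (a′ * q ^ 3) q k
      Ca′ = poch (c′ / (a′ * q)) q k
      Cb′ = poch (b′ * c′ * q ^ 2) (q ^ 3) k
      Cb  = poch (b * c * q ^ 2) (q ^ 3) k
      P1  = poch (1# / (a * q ^ 2)) q (2 *ℕ m)
      Pbm = poch (b / q) q m
      Cam = poch (c / (a * q)) q m
      Ccm = poch (1# / c) q m
      Cdm = poch (b / (a * q ^ 3)) (q ^ 3) m
      Pmk = poch (b / q) q (m ℕ.+ k)
      Camk = poch (c / (a * q)) q (m ℕ.+ k)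
      R = reversalFactor (a * q ^ 2) (2 *ℕ m)
      I = pochRatio (a * q ^ 3) k (2 *ℕ m)
      A′≉0  = nonZeroˡ (nonZeroˡ Den≉0)
      Ca′≉0 = nonZeroʳ (nonZeroˡ Den≉0)
      Cb′≉0 = nonZeroʳ Den≉0
      Cam≉0 = nonZeroˡ (nonZeroˡ Pre≉0)
      Ccm≉0 = nonZeroʳ (nonZeroˡ Pre≉0)
      Cdm≉0 = nonZeroʳ Pre≉0
      Cb≉0  = nonZero-cong (poch-cong (q ^ 3) k b′c′q²≈bcq²) Cb′≉0
      Camk≉0 = nonZero-cong (sym ([c/[aq]]ₘ₊ₖ≈[c/[aq]]ₘ[c′/[a′q]]ₖ k)) (nonZero-* Cam≉0 Ca′≉0)
      Cam⁻¹Ca′⁻¹≈Camk⁻¹ : Cam ⁻¹ * Ca′ ⁻¹ ≈ Camk ⁻¹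
      Cam⁻¹Ca′⁻¹≈Camk⁻¹ =
        sym (trans (⁻¹-cong Camk≉0 ([c/[aq]]ₘ₊ₖ≈[c/[aq]]ₘ[c′/[a′q]]ₖ k)) (⁻¹-distrib-* Cam≉0 Ca′≉0))

    Ω-difference≈Σf : ∀ n →
      (∀ k → k < n → NonZero (ΩDen a b c q k)) → (∀ k → k < n → NonZero (ΩDen a′ b′ c′ q k)) →
      NonZero (poch (c / (a * q)) q m * poch (1# / c) q m * poch (b / (a * q ^ 3)) (q ^ 3) m) →
      Ω a b c q n − Ω a′ b′ c′ q n * prefactor ≈ sumTo n (λ k → f k 0 − f k m)
    Ω-difference≈Σf n Den≉0 Den′≉0 Pre≉0 = begin
      sumTo n term − sumTo n term′ * prefactor
        ≈⟨ +-congˡ (-‿cong (sumTo-distribʳ n term′ prefactor)) ⟩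
      sumTo n term − sumTo n (λ k → term′ k * prefactor)
        ≈⟨ sumTo-− n term (λ k → term′ k * prefactor) ⟩
      sumTo n (λ k → term k − term′ k * prefactor)
        ≈⟨ sumTo-cong n (λ k k<n → +-cong (Ω-term≈f[k,0] k (Den≉0 k k<n))
                                           (-‿cong (Ω′-term*prefactor≈f[k,m] k (Den′≉0 k k<n) Pre≉0))) ⟩
      sumTo n (λ k → f k 0 − f k m) ∎
      where
      term term′ : ℕ → Carrier
      term  k = q ^ k * ΩNum a b c q k / ΩDen a b c q k
      term′ k = q ^ k * ΩNum a′ b′ c′ q k / ΩDen a′ b′ c′ q k

    commonDenominator≉0 : ∀ {n k j} → k < n → j < m →
      NonZero (ΩDen a′ b′ c′ q k) →
      NonZero (poch (c / (a * q)) q m * poch (1# / c) q m * poch (b / (a * q ^ 3)) (q ^ 3) m) →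
      NonZero ((1# − a * q ^ 3 / b) * (1# − 1# / c)) →
      NonZero (poch (a * q ^ 2) q n * poch (c / (a * q)) q n * poch (b * c / q) (q ^ 3) n) →
      NonZero (commonDenominator k j)
    commonDenominator≉0 {k = k} {j} k<n j<m Den′≉0 Pre≉0 φ≉0 Kfac≉0 =
      nonZero-* (nonZero-* (nonZero-* (nonZero-* (nonZero-* (nonZeroˡ φ≉0) Ca≉0) Cf≉0) Cc≉0) Cd≉0)
                (1−c/q^j≉0 {j} (nonZero-poch-factor j<m Ccm≉0))
      where
      Ccm≉0 = nonZeroʳ (nonZeroˡ Pre≉0)
      Camk≉0 : NonZero (poch (c / (a * q)) q (m ℕ.+ k))
      Camk≉0 = nonZero-cong (sym ([c/[aq]]ₘ₊ₖ≈[c/[aq]]ₘ[c′/[a′q]]ₖ k))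
                            (nonZero-* (nonZeroˡ (nonZeroˡ Pre≉0)) (nonZeroʳ (nonZeroˡ Den′≉0)))
      Ca≉0 = nonZero-poch-≤ (ℕ.+-monoˡ-≤ k j<m) Camk≉0
      Cf≉0 = nonZero-poch-≤ k<n (nonZeroʳ Kfac≉0)
      Cc≉0 = nonZero-poch-≤ j<m Ccm≉0
      Cd≉0 = nonZero-poch-≤ j<m (nonZeroʳ Pre≉0)

  constant = (1# − a * q ^ 2) * (1# − q / (b * c)) / ((1# − a * q ^ 3 / b) * (1# − 1# / c))

  Kfactor : ℕ → Carrier
  Kfactor k = poch (b / q) q k * poch c q (2 *ℕ k)
              / (poch (a * q ^ 2) q k * poch (c / (a * q)) q k * poch (b * c / q) (q ^ 3) k)

  module KBoundary (k j : ℕ) (A B C : Carrier)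
                   (A≈ : A ≈ a * q ^ k) (B≈ : B ≈ b * q ^ k) (C≈ : C ≈ c * q ^ (2 *ℕ k)) where
    X = q ^ k
    Y = q ^ j
    X≉0 = q^≉0 k
    Y≉0 = q^≉0 j
    A≉0 = nonZero-cong (sym A≈) (nonZero-* a≉0 X≉0)
    C≉0 = nonZero-cong (sym C≈) (nonZero-* c≉0 (q^≉0 (2 *ℕ k)))
    W = c / Y
    Z = X ^ (2 *ℕ j)
    C/q = C / q
    C/q≉0 = nonZero-* C≉0 (nonZero-⁻¹ q≉0)
    φc = 1# − 1# / c

    W*Y≈c : W * Y ≈ c
    W*Y≈c = trans (*-assoc _ _ _) (trans (*-congˡ (⁻¹-inverseˡ Y≉0)) (*-identityʳ c))

    poch-1/c-reverse : poch (1# / c) q (suc j) ≈ reversalFactor c j * (- (Y / c)) * (poch W q j * (1# − c))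
    poch-1/c-reverse = begin
      poch (1# / c) q (suc j)
        ≈⟨ poch-reverse c≉0 (suc j) ⟩
      reversalFactor c (suc j) * poch (c * q / q ^ suc j) q (suc j)
        ≈⟨ *-congˡ (poch-cong q (suc j) (x*z/[y*z]≈x/y Y≉0 q≉0 c)) ⟩
      reversalFactor c (suc j) * (poch W q j * (1# − W * Y))
        ≈⟨ *-congˡ (*-congˡ (1−-cong W*Y≈c)) ⟩
      reversalFactor c j * (- (Y / c)) * (poch W q j * (1# − c)) ∎

    poch-q/C-reverse : poch (q / C) q j ≈ reversalFactor C/q j * poch (W * q ^ (2 *ℕ k)) q j
    poch-q/C-reverse = trans (poch-cong q j q/C≈1/[C/q])
                      (trans (poch-reverse C/q≉0 j) (*-congˡ (poch-cong q j C/q*q/Y≈W*q^2k)))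
      where
      q/C≈1/[C/q] : q / C ≈ 1# / C/q
      q/C≈1/[C/q] = begin
        q * C ⁻¹                ≈⟨ trans (*-comm q (C ⁻¹)) (sym (*-identityˡ _)) ⟩
        1# * (C ⁻¹ * q)         ≈⟨ *-congˡ (*-congˡ (sym (⁻¹-involutive q≉0))) ⟩
        1# * (C ⁻¹ * (q ⁻¹) ⁻¹) ≈⟨ *-congˡ (sym (⁻¹-distrib-* C≉0 (nonZero-⁻¹ q≉0))) ⟩
        1# / C/q                ∎
      C/q*q/Y≈W*q^2k : C/q * q / Y ≈ W * q ^ (2 *ℕ k)
      C/q*q/Y≈W*q^2k = begin
        C * q ⁻¹ * q * Y ⁻¹      ≈⟨ solve 4 (λ c qi q yi → c :* qi :* q :* yi := c :* yi :* (q :* qi))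
                                            refl C (q ⁻¹) q (Y ⁻¹) ⟩
        C * Y ⁻¹ * (q * q ⁻¹)    ≈⟨ x*[y*y⁻¹]≈x q≉0 _ ⟩
        C * Y ⁻¹                 ≈⟨ *-congʳ C≈ ⟩
        c * q ^ (2 *ℕ k) * Y ⁻¹  ≈⟨ solve 3 (λ c a yi → c :* a :* yi := c :* yi :* a)
                                            refl c (q ^ (2 *ℕ k)) (Y ⁻¹) ⟩
        W * q ^ (2 *ℕ k)         ∎

    poch-W-interchange :
      poch W q (2 *ℕ k) * poch (W * q ^ (2 *ℕ k)) q j ≈ poch W q j * poch c q (2 *ℕ k)
    poch-W-interchange = begin
      poch W q (2 *ℕ k) * poch (W * q ^ (2 *ℕ k)) q j ≈⟨ sym (poch-+ W q (2 *ℕ k) j) ⟩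
      poch W q (2 *ℕ k ℕ.+ j)                        ≡⟨ P.cong (poch W q) (ℕ.+-comm (2 *ℕ k) j) ⟩
      poch W q (j ℕ.+ 2 *ℕ k)                        ≈⟨ poch-+ W q j (2 *ℕ k) ⟩
      poch W q j * poch (W * Y) q (2 *ℕ k)           ≈⟨ *-congˡ (poch-cong q (2 *ℕ k) W*Y≈c) ⟩
      poch W q j * poch c q (2 *ℕ k)                 ∎

    reversalFactor-c≈ : reversalFactor c j * (- (Y / c)) * (1# − c) ≈ Z * reversalFactor C/q j * φc
    reversalFactor-c≈ = begin
      reversalFactor c j * (- (Y / c)) * (1# − c)
        ≈⟨ *-congʳ (*-congʳ (trans (reversalFactor-scale c≉0 s≉0 j)
                                   (*-congʳ (reversalFactor-cong (nonZero-* c≉0 s≉0) c*s≈C/q j)))) ⟩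
      reversalFactor C/q j * s ^ j * (- (Y / c)) * (1# − c)
        ≈⟨ solve 4 (λ r z a b → r :* z :* a :* b := r :* (z :* a :* b))
                   refl (reversalFactor C/q j) (s ^ j) (- (Y / c)) (1# − c) ⟩
      reversalFactor C/q j * (s ^ j * (- (Y / c)) * (1# − c))
        ≈⟨ *-congˡ sʲ-factor ⟩
      reversalFactor C/q j * (Z * φc)
        ≈⟨ solve 3 (λ r z f → r :* (z :* f) := z :* r :* f) refl (reversalFactor C/q j) Z φc ⟩
      Z * reversalFactor C/q j * φc ∎
      where
      s = q ^ (2 *ℕ k) * q ⁻¹
      s≉0 = nonZero-* (q^≉0 (2 *ℕ k)) (nonZero-⁻¹ q≉0)
      c*s≈C/q : c * s ≈ C/q
      c*s≈C/q = trans (sym (*-assoc _ _ _)) (*-congʳ (sym C≈))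
      [q^2k]^j≈Z : (q ^ (2 *ℕ k)) ^ j ≈ Z
      [q^2k]^j≈Z = begin
        (q ^ (2 *ℕ k)) ^ j   ≈⟨ ^-*-assoc q (2 *ℕ k) j ⟩
        q ^ (2 *ℕ k *ℕ j)    ≡⟨ P.cong (q ^_) (P.trans (P.cong (ℕ._* j) (ℕ.*-comm 2 k)) (ℕ.*-assoc k 2 j)) ⟩
        q ^ (k *ℕ (2 *ℕ j))  ≈⟨ sym (^-*-assoc q k (2 *ℕ j)) ⟩
        Z                    ∎
      [q⁻¹]^j*Y≈1 : (q ⁻¹) ^ j * Y ≈ 1#
      [q⁻¹]^j*Y≈1 = trans (sym (^-distribʳ-* (q ⁻¹) q j)) (trans (^-cong j (⁻¹-inverseˡ q≉0)) (1^n≈1 j))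
      sʲ-factor : s ^ j * (- (Y / c)) * (1# − c) ≈ Z * φc
      sʲ-factor = begin
        s ^ j * (- (Y / c)) * (1# − c)
          ≈⟨ *-congʳ (*-congʳ (^-distribʳ-* (q ^ (2 *ℕ k)) (q ⁻¹) j)) ⟩
        (q ^ (2 *ℕ k)) ^ j * (q ⁻¹) ^ j * (- (Y * c ⁻¹)) * (1# − c)
          ≈⟨ solve 6 (λ z qi y ci c o → z :* qi :* (:- (y :* ci)) :* (o :- c)
                                     := z :* (qi :* y) :* ((c :* ci) :- o :* ci))
                     refl ((q ^ (2 *ℕ k)) ^ j) ((q ⁻¹) ^ j) Y (c ⁻¹) c 1# ⟩
        (q ^ (2 *ℕ k)) ^ j * ((q ⁻¹) ^ j * Y) * (c * c ⁻¹ − 1# * c ⁻¹)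
          ≈⟨ *-cong (*-cong [q^2k]^j≈Z [q⁻¹]^j*Y≈1) (+-congʳ (⁻¹-inverseʳ c≉0)) ⟩
        Z * 1# * φc
          ≈⟨ *-congʳ (*-identityʳ Z) ⟩
        Z * φc ∎

    c-factorials : poch c q (2 *ℕ k) * poch (1# / c) q (suc j)
                   ≈ (Z * poch W q (2 *ℕ k)) * (poch (q / C) q j * φc)
    c-factorials = begin
      Qc * poch (1# / c) q (suc j)
        ≈⟨ *-congˡ poch-1/c-reverse ⟩
      Qc * (reversalFactor c j * (- (Y / c)) * (Pj * (1# − c)))
        ≈⟨ solve 5 (λ qc r a pj b → qc :* (r :* a :* (pj :* b)) := (r :* a :* b) :* (pj :* qc))
                   refl Qc (reversalFactor c j) (- (Y / c)) Pj (1# − c) ⟩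
      (reversalFactor c j * (- (Y / c)) * (1# − c)) * (Pj * Qc)
        ≈⟨ *-cong reversalFactor-c≈ (sym poch-W-interchange) ⟩
      (Z * reversalFactor C/q j * φc) * (poch W q (2 *ℕ k) * poch (W * q ^ (2 *ℕ k)) q j)
        ≈⟨ solve 5 (λ z r f pc p → (z :* r :* f) :* (pc :* p) := (z :* pc) :* ((r :* p) :* f))
                   refl Z (reversalFactor C/q j) φc (poch W q (2 *ℕ k)) (poch (W * q ^ (2 *ℕ k)) q j) ⟩
      (Z * poch W q (2 *ℕ k)) * ((reversalFactor C/q j * poch (W * q ^ (2 *ℕ k)) q j) * φc)
        ≈⟨ *-congˡ (*-congʳ (sym poch-q/C-reverse)) ⟩
      (Z * poch W q (2 *ℕ k)) * (poch (q / C) q j * φc) ∎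
      where
      Qc = poch c q (2 *ℕ k)
      Pj = poch W q j

    a-factorials : NonZero (poch (a * q ^ 2) q k) →
                   (1# − a * q ^ 2) * (poch (A * q * q / q ^ (2 *ℕ j)) q (2 *ℕ j) / poch (a * q ^ 2) q k)
                   ≈ pochRatio (a * q ^ 3) k (suc (2 *ℕ j))
    a-factorials Qa≉0 =
      trans (*-congˡ (poch/poch≈pochRatio′ (a * q ^ 2) k (2 *ℕ j) _ lowered Qa≉0))
            (pochRatio-shift (a * q ^ 2) (a * q ^ 3) k (2 *ℕ j) (*-assoc a (q ^ 2) q) Qa≉0)
      where
      lowered : A * q * q / q ^ (2 *ℕ j) * q ^ (2 *ℕ j) ≈ a * q ^ 2 * X
      lowered = begin
        A * q * q * (q ^ (2 *ℕ j)) ⁻¹ * q ^ (2 *ℕ j)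
          ≈⟨ solve 3 (λ x i w → x :* i :* w := x :* (w :* i))
                     refl (A * q * q) ((q ^ (2 *ℕ j)) ⁻¹) (q ^ (2 *ℕ j)) ⟩
        A * q * q * (q ^ (2 *ℕ j) * (q ^ (2 *ℕ j)) ⁻¹)
          ≈⟨ x*[y*y⁻¹]≈x (q^≉0 (2 *ℕ j)) _ ⟩
        A * q * q
          ≈⟨ *-congʳ (*-congʳ A≈) ⟩
        a * X * q * q
          ≈⟨ solve 3 (λ a x q → a :* x :* q :* q := a :* (q :* q) :* x) refl a X q ⟩
        a * (q * q) * X
          ≈⟨ *-congʳ (*-congˡ (sym (x^2≈x*x q))) ⟩
        a * q ^ 2 * X ∎

    reversalFactor[Aq]*Z≈reversalFactor[aq] : reversalFactor (A * q) (2 *ℕ j) * Z ≈ reversalFactor (a * q) (2 *ℕ j)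
    reversalFactor[Aq]*Z≈reversalFactor[aq] =
      sym (trans (reversalFactor-scale (nonZero-* a≉0 q≉0) X≉0 (2 *ℕ j))
                 (*-congʳ (reversalFactor-cong (nonZero-* (nonZero-* a≉0 q≉0) X≉0) aqX≈Aq (2 *ℕ j))))
      where
      aqX≈Aq : a * q * X ≈ A * q
      aqX≈Aq = trans (solve 3 (λ a q x → a :* q :* x := a :* x :* q) refl a q X) (*-congʳ (sym A≈))

    poch-split-j+k : ∀ x → poch x q (j ℕ.+ k) ≈ poch x q k * poch (x * X) q j
    poch-split-j+k x = trans (reflexive (P.cong (poch x q) (ℕ.+-comm j k))) (poch-+ x q k j)

    [B/q]ⱼ[b/q]ₖ≈[b/q]ⱼ₊ₖ : poch (B / q) q j * poch (b / q) q k ≈ poch (b / q) q (j ℕ.+ k)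
    [B/q]ⱼ[b/q]ₖ≈[b/q]ⱼ₊ₖ =
      sym (trans (poch-split-j+k (b / q)) (trans (*-congˡ (poch-cong q j b/q*X≈B/q)) (*-comm _ _)))
      where
      b/q*X≈B/q : b / q * X ≈ B / q
      b/q*X≈B/q = trans (solve 3 (λ b i x → b :* i :* x := b :* x :* i) refl b (q ⁻¹) X) (*-congʳ (sym B≈))

    c/[aq]*X≈C/[Aq] : c / (a * q) * X ≈ C / (A * q)
    c/[aq]*X≈C/[Aq] = sym (begin
      C / (A * q)
        ≈⟨ *-cong (trans C≈ (*-congˡ (x^[2*n]≈x^n*x^n q k))) (⁻¹-cong (nonZero-* A≉0 q≉0) (*-congʳ A≈)) ⟩
      c * (X * X) * (a * X * q) ⁻¹
        ≈⟨ *-congˡ (⁻¹-distrib-*³ a≉0 X≉0 q≉0) ⟩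
      c * (X * X) * (a ⁻¹ * X ⁻¹ * q ⁻¹)
        ≈⟨ solve 5 (λ c x ai xi qi → c :* (x :* x) :* (ai :* xi :* qi) := c :* (ai :* qi) :* x :* (x :* xi))
                   refl c X (a ⁻¹) (X ⁻¹) (q ⁻¹) ⟩
      c * (a ⁻¹ * q ⁻¹) * X * (X * X ⁻¹)
        ≈⟨ x*[y*y⁻¹]≈x X≉0 _ ⟩
      c * (a ⁻¹ * q ⁻¹) * X
        ≈⟨ *-congʳ (*-congˡ (sym (⁻¹-distrib-* a≉0 q≉0))) ⟩
      c / (a * q) * X ∎)

    [c/[aq]]ⱼ₊ₖ≈[c/[aq]]ₖ[C/[Aq]]ⱼ :
      poch (c / (a * q)) q (j ℕ.+ k) ≈ poch (c / (a * q)) q k * poch (C / (A * q)) q j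
    [c/[aq]]ⱼ₊ₖ≈[c/[aq]]ₖ[C/[Aq]]ⱼ =
      trans (poch-split-j+k (c / (a * q))) (*-congˡ (poch-cong q j c/[aq]*X≈C/[Aq]))

    B/A≈b/a : B / A ≈ b / a
    B/A≈b/a = trans (*-cong B≈ (⁻¹-cong A≉0 A≈)) (x*z/[y*z]≈x/y a≉0 X≉0 b)

    K-term*Kfactor≈g :
      NonZero (KDen A B C q j) →
      NonZero (poch (a * q ^ 2) q k * poch (c / (a * q)) q k * poch (b * c / q) (q ^ 3) k) →
      NonZero ((1# − a * q ^ 3 / b) * φc) → NonZero (poch (1# / c) q (suc j)) →
      constant * (q ^ j * KNum A B C q j / KDen A B C q j * Kfactor k) ≈ g k j
    K-term*Kfactor≈g KDen≉0 Kfac≉0 φ≉0 C1j≉0 = begin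
      (φaq² * φqbc) / (φa * φc) * ((q ^ j * (N1 * N2)) / (D1 * D2 * D3) * ((Qb * Qc) / (Qa * Qca * Qbc)))
        ≈⟨ *-cong (*-congˡ (⁻¹-distrib-* φa≉0 φc≉0))
                  (*-cong (*-cong (*-congˡ (*-congʳ (poch-reverse (nonZero-* A≉0 q≉0) (2 *ℕ j))))
                                  (⁻¹-distrib-*³ D1≉0 D2≉0 D3≉0))
                          (*-congˡ (⁻¹-distrib-*³ Qa≉0 Qca≉0 Qbc≉0))) ⟩
      (φaq² * φqbc) * (φa ⁻¹ * φc ⁻¹)
        * ((q ^ j * ((R * Pw) * N2)) * (D1 ⁻¹ * D2 ⁻¹ * D3 ⁻¹) * ((Qb * Qc) * (Qa ⁻¹ * Qca ⁻¹ * Qbc ⁻¹)))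
        ≈⟨ solve 16 (λ o fm fai fci y r pw n2 d1 d2 d3 qb qc qa qca qbc →
             (o :* fm) :* (fai :* fci)
               :* ((y :* ((r :* pw) :* n2)) :* (d1 :* d2 :* d3) :* ((qb :* qc) :* (qa :* qca :* qbc)))
             := fm :* y :* (o :* (pw :* qa)) :* r :* (n2 :* qb) :* (qc :* d1 :* fci) :* (d2 :* qca)
                  :* d3 :* qbc :* fai)
             refl φaq² φqbc (φa ⁻¹) (φc ⁻¹) (q ^ j) R Pw N2 (D1 ⁻¹) (D2 ⁻¹) (D3 ⁻¹)
                  Qb Qc (Qa ⁻¹) (Qca ⁻¹) (Qbc ⁻¹) ⟩
      φqbc * q ^ j * (φaq² * (Pw / Qa)) * R * (N2 * Qb) * (Qc / D1 / φc) * (D2 ⁻¹ * Qca ⁻¹) * D3 ⁻¹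
        * Qbc ⁻¹ * φa ⁻¹
        ≈⟨ *-congʳ (*-congʳ (*-cong (*-cong (*-cong (*-cong (*-congʳ (*-congˡ (a-factorials Qa≉0)))
                                                            [B/q]ⱼ[b/q]ₖ≈[b/q]ⱼ₊ₖ)
                                                    c-part)
                                            ca-part)
                                    (⁻¹-cong D3≉0 (poch-cong (q ^ 3) j B/A≈b/a)))) ⟩
      φqbc * q ^ j * I * R * Pbjk * (Z * Pc / C1j) * Cajk ⁻¹ * Ce ⁻¹ * Qbc ⁻¹ * φa ⁻¹
        ≈⟨ solve 12 (λ fm y i r pb z pc c1 ca ce qbc fa →
             fm :* y :* i :* r :* pb :* (z :* pc :* c1) :* ca :* ce :* qbc :* fa
               := fm :* y :* (r :* z) :* i :* pb :* pc :* (fa :* ca :* ce :* qbc :* c1))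
             refl φqbc (q ^ j) I R Pbjk Z Pc (C1j ⁻¹) (Cajk ⁻¹) (Ce ⁻¹) (Qbc ⁻¹) (φa ⁻¹) ⟩
      φqbc * q ^ j * (R * Z) * I * Pbjk * Pc * (φa ⁻¹ * Cajk ⁻¹ * Ce ⁻¹ * Qbc ⁻¹ * C1j ⁻¹)
        ≈⟨ *-cong (*-congʳ (*-congʳ (*-congʳ (*-congˡ reversalFactor[Aq]*Z≈reversalFactor[aq]))))
                  (sym (⁻¹-distrib-*⁵ φa≉0 Cajk≉0 Ce≉0 Qbc≉0 C1j≉0)) ⟩
      g k j ∎
      where
      φaq² = 1# − a * q ^ 2
      φa   = 1# − a * q ^ 3 / b
      φqbc = 1# − q / (b * c)
      N1   = poch (1# / (A * q)) q (2 *ℕ j)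
      N2   = poch (B / q) q j
      D1   = poch (q / C) q j
      D2   = poch (C / (A * q)) q j
      D3   = poch (B / A) (q ^ 3) j
      Qb   = poch (b / q) q k
      Qc   = poch c q (2 *ℕ k)
      Qa   = poch (a * q ^ 2) q k
      Qca  = poch (c / (a * q)) q k
      Qbc  = poch (b * c / q) (q ^ 3) k
      Pw   = poch (A * q * q / q ^ (2 *ℕ j)) q (2 *ℕ j)
      Pc   = poch W q (2 *ℕ k)
      C1j  = poch (1# / c) q (suc j)
      R    = reversalFactor (A * q) (2 *ℕ j)
      I    = pochRatio (a * q ^ 3) k (suc (2 *ℕ j))
      Pbjk = poch (b / q) q (j ℕ.+ k)
      Cajk = poch (c / (a * q)) q (j ℕ.+ k)
      Ce   = poch (b / a) (q ^ 3) j
      D1≉0  = nonZeroˡ (nonZeroˡ KDen≉0)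
      D2≉0  = nonZeroʳ (nonZeroˡ KDen≉0)
      D3≉0  = nonZeroʳ KDen≉0
      Qa≉0  = nonZeroˡ (nonZeroˡ Kfac≉0)
      Qca≉0 = nonZeroʳ (nonZeroˡ Kfac≉0)
      Qbc≉0 = nonZeroʳ Kfac≉0
      φa≉0  = nonZeroˡ φ≉0
      φc≉0  = nonZeroʳ φ≉0
      Ce≉0  = nonZero-cong (poch-cong (q ^ 3) j B/A≈b/a) D3≉0
      Cajk≉0 = nonZero-cong (sym [c/[aq]]ⱼ₊ₖ≈[c/[aq]]ₖ[C/[Aq]]ⱼ) (nonZero-* Qca≉0 D2≉0)
      c-part : Qc / D1 / φc ≈ Z * Pc / C1j
      c-part = trans (trans (*-assoc _ _ _) (*-congˡ (sym (⁻¹-distrib-* D1≉0 φc≉0))))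
                     (/-cross C1j≉0 (nonZero-* D1≉0 φc≉0) c-factorials)
      ca-part : D2 ⁻¹ * Qca ⁻¹ ≈ Cajk ⁻¹
      ca-part = sym (trans (⁻¹-cong Cajk≉0 [c/[aq]]ⱼ₊ₖ≈[c/[aq]]ₖ[C/[Aq]]ⱼ)
                           (trans (⁻¹-distrib-* Qca≉0 D2≉0) (*-comm _ _)))

  K-difference≈Σg : ∀ n m →
    (∀ j → j < m → NonZero (KDen a b c q j)) →
    (∀ j → j < m → NonZero (KDen (a * q ^ n) (b * q ^ n) (c * q ^ (2 *ℕ n)) q j)) →
    NonZero (poch (1# / c) q m) →
    NonZero ((1# − a * q ^ 3 / b) * (1# − 1# / c)) →
    NonZero (poch (a * q ^ 2) q n * poch (c / (a * q)) q n * poch (b * c / q) (q ^ 3) n) →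
    constant * (K a b c q m − K (a * q ^ n) (b * q ^ n) (c * q ^ (2 *ℕ n)) q m * Kfactor n)
    ≈ sumTo m (λ j → g 0 j − g n j)
  K-difference≈Σg n m KDen≉0 KDen′≉0 Ccm≉0 φ≉0 Kfac≉0 = begin
    constant * (sumTo m term − sumTo m term′ * Kfactor n)
      ≈⟨ *-congˡ (+-congˡ (-‿cong (sumTo-distribʳ m term′ (Kfactor n)))) ⟩
    constant * (sumTo m term − sumTo m (λ j → term′ j * Kfactor n))
      ≈⟨ *-congˡ (sumTo-− m term (λ j → term′ j * Kfactor n)) ⟩
    constant * sumTo m (λ j → term j − term′ j * Kfactor n)
      ≈⟨ sumTo-distribˡ m (λ j → term j − term′ j * Kfactor n) constant ⟩
    sumTo m (λ j → constant * (term j − term′ j * Kfactor n))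
      ≈⟨ sumTo-cong m (λ j j<m → trans (distribˡ constant (term j) _)
                                        (+-cong (lower j j<m) (trans (sym (-‿distribʳ-* _ _)) (-‿cong (upper j j<m))))) ⟩
    sumTo m (λ j → g 0 j − g n j) ∎
    where
    term term′ : ℕ → Carrier
    term  j = q ^ j * KNum a b c q j / KDen a b c q j
    term′ j = q ^ j * KNum (a * q ^ n) (b * q ^ n) (c * q ^ (2 *ℕ n)) q j
                    / KDen (a * q ^ n) (b * q ^ n) (c * q ^ (2 *ℕ n)) q j
    Kfactor0≈1 : Kfactor 0 ≈ 1#
    Kfactor0≈1 = trans (*-cong (*-identityˡ 1#) (trans (⁻¹-cong (nonZero-* (nonZero-* nonZero-1 nonZero-1) nonZero-1)
                                                                (trans (*-identityʳ _) (*-identityʳ _))) 1⁻¹≈1))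
                       (*-identityʳ 1#)
    lower : ∀ j → j < m → constant * term j ≈ g 0 j
    lower j j<m = trans (*-congˡ (sym (trans (*-congˡ Kfactor0≈1) (*-identityʳ (term j)))))
      (KBoundary.K-term*Kfactor≈g 0 j a b c (sym (*-identityʳ a)) (sym (*-identityʳ b)) (sym (*-identityʳ c))
         (KDen≉0 j j<m) (nonZero-* (nonZero-* nonZero-1 nonZero-1) nonZero-1) φ≉0 (nonZero-poch-≤ j<m Ccm≉0))
    upper : ∀ j → j < m → constant * (term′ j * Kfactor n) ≈ g n j
    upper j j<m = KBoundary.K-term*Kfactor≈g n j (a * q ^ n) (b * q ^ n) (c * q ^ (2 *ℕ n)) refl refl refl
                    (KDen′≉0 j j<m) Kfac≉0 φ≉0 (nonZero-poch-≤ j<m Ccm≉0)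

corollary3p3 : ∀ {α β : Level} (F : Field α β) →
    let open Field F
        open FieldOps F
    in ∀ (a b c q : Carrier) (m n : ℕ) →
       NonZero a → NonZero b → NonZero c → NonZero q →
       (∀ k → k < n → NonZero (ΩDen a b c q k)) →
       (∀ k → k < n → NonZero (ΩDen (a / q ^ (2 *ℕ m)) (b * q ^ m) (c / q ^ m) q k)) →
       NonZero (poch (c / (a * q)) q m * poch (1# / c) q m * poch (b / (a * q ^ 3)) (q ^ 3) m) →
       NonZero ((1# − a * q ^ 3 / b) * (1# − 1# / c)) →
       (∀ k → k < m → NonZero (KDen a b c q k)) →
       (∀ k → k < m → NonZero (KDen (a * q ^ n) (b * q ^ n) (c * q ^ (2 *ℕ n)) q k)) →
       NonZero (poch (a * q ^ 2) q n * poch (c / (a * q)) q n * poch (b * c / q) (q ^ 3) n) →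
       Ω a b c q n
         − Ω (a / q ^ (2 *ℕ m)) (b * q ^ m) (c / q ^ m) q n
           * (poch (1# / (a * q ^ 2)) q (2 *ℕ m) * poch (b / q) q m
              / (poch (c / (a * q)) q m * poch (1# / c) q m * poch (b / (a * q ^ 3)) (q ^ 3) m))
       ≈ (1# − a * q ^ 2) * (1# − q / (b * c)) / ((1# − a * q ^ 3 / b) * (1# − 1# / c))
         * (K a b c q m
            − K (a * q ^ n) (b * q ^ n) (c * q ^ (2 *ℕ n)) q m
              * (poch (b / q) q n * poch c q (2 *ℕ n)
                 / (poch (a * q ^ 2) q n * poch (c / (a * q)) q n * poch (b * c / q) (q ^ 3) n)))
corollary3p3 F a b c q m n a≉0 b≉0 c≉0 q≉0 ΩDen≉0 ΩDen′≉0 Pre≉0 φ≉0 KDen≉0 KDen′≉0 Kfac≉0 = begin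
  Ω a b c q n − Ω a′ b′ c′ q n * prefactor
    ≈⟨ Ω-difference≈Σf n ΩDen≉0 ΩDen′≉0 Pre≉0 ⟩
  sumTo n (λ k → f k 0 − f k m)
    ≈⟨ sumTo-double-telescope f g n m (λ k j k<n j<m →
         LocalIdentity.local-identity k j (nonZeroˡ (nonZeroˡ (ΩDen≉0 k k<n)))
           (commonDenominator≉0 k<n j<m (ΩDen′≉0 k k<n) Pre≉0 φ≉0 Kfac≉0)) ⟩
  sumTo m (λ j → g 0 j − g n j)
    ≈⟨ K-difference≈Σg n m KDen≉0 KDen′≉0 (nonZeroʳ (nonZeroˡ Pre≉0)) φ≉0 Kfac≉0 ⟨
  constant * (K a b c q m − K (a * q ^ n) (b * q ^ n) (c * q ^ (2 *ℕ n)) q m * Kfactor n) ∎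
  where
  open Field F
  open FieldOps F
  open FieldProperties F using (nonZeroˡ; nonZeroʳ)
  open Summation F using (sumTo-double-telescope)
  open Certificate F a b c q a≉0 b≉0 c≉0 q≉0
  open Shifted m
  open import Relation.Binary.Reasoning.Setoid setoid
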